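{- Let $n_1<n_2<\dots<n_k$ be positive integers and $\beta=(\beta_1,\dots,\beta_k)$ a weak composition. Then $$n_1^{\beta_1}n_2^{\beta_2}\cdots n_k^{\beta_k}=\sum_{I=(i_1,\dots,i_k)}c_{\beta,I}\binom{n_1-1}{i_1}\binom{n_2-n_1-1}{i_2}\cdots\binom{n_k-n_{k-1}-1}{i_k},$$ where the sum runs over $I\in\mathbb{N}^k$ with $\sum_{t=j}^k i_t\le\sum_{t=j}^k\beta_t$ for $j=1,\dots,k$, with the conventions $c_{0^k,I}=1$ and $\binom{m}{n}=0$ if $m<n$.
   Context: Set $n_0=0$, $b_j=\beta_1+\dots+\beta_j$, $[m]=\{1,\dots,m\}$, $[a,b]=\{a,\dots,b\}$. Let $u_1,\dots,u_k$ be symbols not in $[b_k]$. A filtered pointed map is a map $\bar f:[b_k]\cup\{u_1,\dots,u_k\}\to[n_k]$ with $\bar f([b_j])\subseteq[n_j]$ and $\bar f(u_j)=n_j$ for $1\le j\le k$. For $I=(i_1,\dots,i_k)$, $c_{\beta,I}$ is the number of filtered pointed maps $\bar f$ with $\mathrm{im}\,\bar f\cap[n_{j-1}+1,n_j-1]=Y_j$ for all $1\le j\le k$, where $Y_j\subseteq[n_{j-1}+1,n_j-1]$ are fixed subsets with $|Y_j|=i_j$; this number depends only on $\beta$ and $I$ (not on the choice of the $n_j$ and $Y_j$ for which such subsets exist). -}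

module Defs where

open import Data.Nat using (ℕ; zero; suc; _+_; _*_; _∸_; _^_; _<_; _≤ᵇ_; _<ᵇ_; _≡ᵇ_)
open import Data.Bool using (Bool; true; false; _∧_; if_then_else_; not; _∨_)
open import Data.Product using (_×_; _,_)
open import Data.Fin using (Fin; toℕ; fromℕ; inject₁) renaming (zero to fz; suc to fs)
open import Data.List as L using (List; []; _∷_; _++_)
open import Data.Vec as V using (Vec; lookup)
open import Data.Bool.ListAction using (all; any)
open import Data.Nat.ListAction using (sum)

_⇒ᵇ_ : Bool → Bool → Bool
a ⇒ᵇ b = not a ∨ b

_==ᵇ_ : Bool → Bool → Bool
true  ==ᵇ b = b
false ==ᵇ b = not b

allFinᵇ : (m : ℕ) → (Fin m → Bool) → Bool
allFinᵇ m p = all p (L.allFin m)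

interval : ℕ → ℕ → List ℕ
interval a b = L.map (a +_) (L.upTo (suc b ∸ a))

_∈ᵇ_ : ℕ → List ℕ → Bool
y ∈ᵇ xs = any (y ≡ᵇ_) xs

allVecs : (m : ℕ) → List ℕ → List (Vec ℕ m)
allVecs zero    vals = V.[] ∷ []
allVecs (suc m) vals =
  L.concatMap (λ v → L.map (v V.∷_) (allVecs m vals)) vals

prefixFrom : {k : ℕ} → ℕ → Vec ℕ k → Vec ℕ k
prefixFrom a V.[]       = V.[]
prefixFrom a (x V.∷ xs) = (a + x) V.∷ prefixFrom (a + x) xs

prefix : {k : ℕ} → Vec ℕ k → Vec ℕ k
prefix = prefixFrom 0

-- For n = (n₁,…,n_k) (0-based Fin index j standing for paper index j+1):
-- nAt n j = n_{j+1},  nBefore n j = n_j  (with n₀ = 0),  nTop n = n_k.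
nAt : {k : ℕ} → Vec ℕ k → Fin k → ℕ
nAt n j = lookup n j

nBefore : {k : ℕ} → Vec ℕ k → Fin k → ℕ
nBefore n j = lookup (0 V.∷ n) (inject₁ j)

nTop : {k : ℕ} → Vec ℕ k → ℕ
nTop {k} n = lookup (0 V.∷ n) (fromℕ k)

gap : {k : ℕ} → Vec ℕ k → Fin k → List ℕ
gap n j = interval (suc (nBefore n j)) (nAt n j ∸ 1)

-- A filtered pointed map  f̄ : [b_k] ∪ {u₁,…,u_k} → [n_k]  is represented by
-- the pair (f , g) where  f : Vec ℕ b_k  lists f̄(1),…,f̄(b_k)  (position
-- x : Fin b_k stands for the element toℕ x + 1)  and  g : Vec ℕ k  lists
-- f̄(u₁),…,f̄(u_k).  Candidates range over all such pairs with values in [n_k].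
isFPM : {k : ℕ} (β n : Vec ℕ k) → Vec ℕ (V.sum β) × Vec ℕ k → Bool
isFPM {k} β n (f , g) = filtered ∧ pointed
  where
  b = prefix β
  filtered = allFinᵇ k (λ j → allFinᵇ (V.sum β) (λ x →
               (toℕ x <ᵇ lookup b j) ⇒ᵇ (lookup f x ≤ᵇ nAt n j)))
  pointed  = allFinᵇ k (λ j → lookup g j ≡ᵇ nAt n j)

image : {k m : ℕ} → Vec ℕ m × Vec ℕ k → List ℕ
image (f , g) = V.toList f ++ V.toList g

imageCond : {k m : ℕ} (n : Vec ℕ k) (Y : Vec (List ℕ) k) → Vec ℕ m × Vec ℕ k → Bool
imageCond {k} n Y fg = allFinᵇ k (λ j →
  all (λ y → (y ∈ᵇ image fg) ==ᵇ (y ∈ᵇ lookup Y j)) (gap n j))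

countFPM : {k : ℕ} (β n : Vec ℕ k) (Y : Vec (List ℕ) k) → ℕ
countFPM {k} β n Y = L.length (L.filterᵇ (λ fg → isFPM β n fg ∧ imageCond n Y fg)
  (L.cartesianProduct (allVecs (V.sum β) (interval 1 (nTop n)))
                      (allVecs k (interval 1 (nTop n)))))

-- c_{β,I}: by the paper, countFPM depends only on β and I = (|Y_j|)_j. We evaluate
-- it at the canonical choice n_j = (i₁+1)+…+(i_j+1), Y_j = [n_{j-1}+1, n_j-1]
-- (so |Y_j| = i_j), together with the stated convention c_{0^k,I} = 1.
canonN : {k : ℕ} → Vec ℕ k → Vec ℕ k
canonN I = prefix (V.map suc I)

isZeroVec : {k : ℕ} → Vec ℕ k → Bool
isZeroVec v = all (_≡ᵇ 0) (V.toList v)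

c : {k : ℕ} (β I : Vec ℕ k) → ℕ
c {k} β I = if isZeroVec β then 1
            else countFPM β (canonN I) (V.tabulate (gap (canonN I)))

-- n₁ < n₂ < … < n_k with n₁ positive, i.e. n_{j-1} < n_j for all j (n₀ = 0)
PosStrictIncr : {k : ℕ} → Vec ℕ k → Set
PosStrictIncr {k} n = (j : Fin k) → nBefore n j < nAt n j

sufSum : {k : ℕ} → Vec ℕ k → Fin k → ℕ
sufSum {k} v j = sum (L.map (λ i → if toℕ j ≤ᵇ toℕ i then lookup v i else 0) (L.allFin k))

-- the index set { I ∈ ℕ^k : ∑_{t≥j} i_t ≤ ∑_{t≥j} β_t for all j }, enumerated
-- inside the box [0, β₁+…+β_k]^k (which contains it, by the j = 1 condition)
indexSet : {k : ℕ} → Vec ℕ k → List (Vec ℕ k)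
indexSet {k} β = L.filterᵇ
  (λ I → allFinᵇ k (λ j → sufSum I j ≤ᵇ sufSum β j))
  (allVecs k (interval 0 (V.sum β)))

lhs : {k : ℕ} (n β : Vec ℕ k) → ℕ
lhs n β = V.foldr _ _*_ 1 (V.zipWith _^_ n β)

-- Write g_t = n_t - n_(t-1) - 1 for the gap sizes, so that n_j = Σ_(t≤j) (g_t + 1), and list the
-- block index of each point of the domain as js = (1^β₁, …, k^β_k). The coefficients φ js I are
-- defined by recursion on js, following where the first point of a map can go. Counting: for every ascending n and every choice of sets Y_t inside
-- the gaps, the number of maps x ↦ f x ≤ n_(js x) whose image meets the gaps exactly in the Y_t is
-- φ js (|Y_t|)_t; in particular c_(β,I) = φ js I. Algebra: Π_x n_(js x) = Σ_I φ js I Π_t C(g_t, I_t),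
-- because multiplying by n_j = Σ_(t≤j) (g_t + 1) matches the recursion of φ once the absorption
-- identity (v+1)·C(g,v+1) + v·C(g,v) = g·C(g,v) is used to shift the index I_t. Finally φ js I
-- vanishes unless the suffix sums of I are bounded by those of β, which cuts the sum down to the
-- index set of the statement.

module Submission where

open import Defs

open import Data.Bool using (Bool; true; false; _∧_; _∨_; not; if_then_else_; T)
open import Data.Bool.ListAction using (all)
open import Data.Bool.Properties using (∨-zeroʳ; ∨-identityʳ; ∨-assoc; ∧-zeroʳ; ∧-identityʳ; ∧-assoc; ⇔→≡)
open import Data.Empty using (⊥-elim)
open import Data.Fin as Fin using (Fin; toℕ; fromℕ; inject₁) renaming (zero to fz; suc to fs)
open import Data.Fin.Properties using (toℕ-injective)
open import Data.List as L using (List; []; _∷_; _++_)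
import Data.List.Properties as LP
open import Data.List.Membership.Propositional using (_∈_; lose)
open import Data.List.Membership.Propositional.Properties using (∈-allFin; ∈-concatMap⁺; ∈-concatMap⁻)
import Data.List.Relation.Unary.All as All
open import Data.List.Relation.Unary.All.Properties using (all⁺; all⁻; tabulate⁺)
open import Data.List.Relation.Unary.Any as Any using (here; there)
open import Data.Nat using (ℕ; zero; suc; _+_; _*_; _∸_; _^_; _≤_; _<_; _≤ᵇ_; _<ᵇ_; _≡ᵇ_; z≤n; s≤s; _≟_)
open import Data.Nat.Combinatorics using (_C_; nCk+nC[k+1]≡[n+1]C[k+1]; k>n⇒nCk≡0; nC1≡n)
open import Data.Nat.ListAction using (sum)
open import Data.Nat.ListAction.Properties using (sum-++)
open import Data.Nat.Properties
open import Algebra.Properties.CommutativeSemigroup +-commutativeSemigroup using (interchange)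
open import Algebra.Properties.CommutativeSemigroup *-commutativeSemigroup using (x∙yz≈y∙xz)
open import Data.Nat.Tactic.RingSolver using (solve-∀)
open import Data.Product using (_×_; _,_; Σ; proj₁; proj₂)
open import Data.Sum using (_⊎_; inj₁; inj₂)
open import Data.Unit using (⊤)
open import Data.Vec as V using (Vec; []; _∷_; lookup)
import Data.Vec.Properties as VP
open import Function using (_∘_; mk⇔)
open import Relation.Binary.Definitions using (tri<; tri≈; tri>)
open import Relation.Binary.PropositionalEquality
open import Relation.Nullary using (yes; no; ¬_)

𝟙 : Bool → ℕ
𝟙 true  = 1
𝟙 false = 0

T⇒≡true : ∀ {b} → T b → b ≡ true
T⇒≡true {true} _ = refl

≡true⇒T : ∀ {b} → b ≡ true → T b
≡true⇒T refl = _

𝟙-∧ : ∀ a b → 𝟙 (a ∧ b) ≡ 𝟙 a * 𝟙 b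
𝟙-∧ true  b = sym (+-identityʳ (𝟙 b))
𝟙-∧ false b = refl

∑ : {A : Set} → List A → (A → ℕ) → ℕ
∑ xs f = sum (L.map f xs)

syntax ∑ xs (λ x → e) = ∑[ x ∈ xs ] e

module _ {A : Set} where

  ∑-++ : ∀ (xs ys : List A) f → ∑ (xs ++ ys) f ≡ ∑ xs f + ∑ ys f
  ∑-++ xs ys f = trans (cong sum (LP.map-++ f xs ys)) (sum-++ (L.map f xs) _)

  ∑-cong-∈ : ∀ (xs : List A) {f g} → (∀ x → x ∈ xs → f x ≡ g x) → ∑ xs f ≡ ∑ xs g
  ∑-cong-∈ []       e = refl
  ∑-cong-∈ (x ∷ xs) e = cong₂ _+_ (e x (here refl)) (∑-cong-∈ xs (λ y y∈xs → e y (there y∈xs)))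

  ∑-cong : ∀ (xs : List A) {f g} → (∀ x → f x ≡ g x) → ∑ xs f ≡ ∑ xs g
  ∑-cong xs e = ∑-cong-∈ xs (λ x _ → e x)

  ∑-+ : ∀ (xs : List A) f g → ∑[ x ∈ xs ] (f x + g x) ≡ ∑ xs f + ∑ xs g
  ∑-+ []       f g = refl
  ∑-+ (x ∷ xs) f g = trans (cong (f x + g x +_) (∑-+ xs f g)) (interchange (f x) (g x) _ _)

  ∑-*ˡ : ∀ (xs : List A) c f → ∑[ x ∈ xs ] (c * f x) ≡ c * ∑ xs f
  ∑-*ˡ []       c f = sym (*-zeroʳ c)
  ∑-*ˡ (x ∷ xs) c f = trans (cong (c * f x +_) (∑-*ˡ xs c f)) (sym (*-distribˡ-+ c (f x) _))

  ∑-zero : ∀ (xs : List A) {f} → (∀ x → x ∈ xs → f x ≡ 0) → ∑ xs f ≡ 0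
  ∑-zero []       e = refl
  ∑-zero (x ∷ xs) e = cong₂ _+_ (e x (here refl)) (∑-zero xs (λ y y∈xs → e y (there y∈xs)))

  ∑-1≡length : ∀ (xs : List A) → ∑[ x ∈ xs ] 1 ≡ L.length xs
  ∑-1≡length []       = refl
  ∑-1≡length (x ∷ xs) = cong suc (∑-1≡length xs)

  ∑-filterᵇ : ∀ p (xs : List A) f → ∑ (L.filterᵇ p xs) f ≡ ∑[ x ∈ xs ] (𝟙 (p x) * f x)
  ∑-filterᵇ p []       f = refl
  ∑-filterᵇ p (x ∷ xs) f with p x
  ... | true  = cong₂ _+_ (sym (+-identityʳ (f x))) (∑-filterᵇ p xs f)
  ... | false = ∑-filterᵇ p xs f

  length-filterᵇ : ∀ p (xs : List A) → L.length (L.filterᵇ p xs) ≡ ∑[ x ∈ xs ] 𝟙 (p x)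
  length-filterᵇ p []       = refl
  length-filterᵇ p (x ∷ xs) with p x
  ... | true  = cong suc (length-filterᵇ p xs)
  ... | false = length-filterᵇ p xs

∑≡0⇒ : ∀ {A : Set} (xs : List A) f → ∑ xs f ≡ 0 → ∀ x → x ∈ xs → f x ≡ 0
∑≡0⇒ (y ∷ xs) f ∑≡0 x (here refl) = m+n≡0⇒m≡0 (f y) ∑≡0
∑≡0⇒ (y ∷ xs) f ∑≡0 x (there x∈) = ∑≡0⇒ xs f (m+n≡0⇒n≡0 (f y) ∑≡0) x x∈

∑-map : ∀ {A B : Set} (g : A → B) xs f → ∑ (L.map g xs) f ≡ ∑ xs (f ∘ g)
∑-map g xs f = cong sum (sym (LP.map-∘ xs))

module _ {A B : Set} where

  ∑-concatMap : ∀ (g : A → List B) xs f → ∑ (L.concatMap g xs) f ≡ ∑[ x ∈ xs ] ∑ (g x) f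
  ∑-concatMap g []       f = refl
  ∑-concatMap g (x ∷ xs) f = trans (∑-++ (g x) _ f) (cong (∑ (g x) f +_) (∑-concatMap g xs f))

  ∑-comm : ∀ (xs : List A) (ys : List B) (f : A → B → ℕ) →
    ∑[ x ∈ xs ] ∑[ y ∈ ys ] f x y ≡ ∑[ y ∈ ys ] ∑[ x ∈ xs ] f x y
  ∑-comm []       ys f = sym (∑-zero ys (λ _ _ → refl))
  ∑-comm (x ∷ xs) ys f = trans (cong (∑ ys (f x) +_) (∑-comm xs ys f))
      (sym (∑-+ ys (f x) (λ y → ∑[ x′ ∈ xs ] f x′ y)))

  ∑-cartesianProduct : ∀ (xs : List A) (ys : List B) h →
    ∑ (L.cartesianProduct xs ys) h ≡ ∑[ x ∈ xs ] ∑[ y ∈ ys ] h (x , y)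
  ∑-cartesianProduct []       ys h = refl
  ∑-cartesianProduct (x ∷ xs) ys h =
    trans (∑-++ (L.map (x ,_) ys) _ h) (cong₂ _+_ (∑-map (x ,_) ys h) (∑-cartesianProduct xs ys h))

bool-ext : ∀ {a b} → (a ≡ true → b ≡ true) → (b ≡ true → a ≡ true) → a ≡ b
bool-ext a⇒b b⇒a = ⇔→≡ (mk⇔ a⇒b b⇒a)

⇒ᵇ-elim : ∀ {a b} → (a ⇒ᵇ b) ≡ true → a ≡ true → b ≡ true
⇒ᵇ-elim {true} a⇒b refl = a⇒b

⇒ᵇ-intro : ∀ {a b} → (a ≡ true → b ≡ true) → (a ⇒ᵇ b) ≡ true
⇒ᵇ-intro {true}  a⇒b = a⇒b refl
⇒ᵇ-intro {false} a⇒b = refl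

module _ {A : Set} where

  all-cong-∈ : ∀ (xs : List A) {p q} → (∀ x → x ∈ xs → p x ≡ q x) → all p xs ≡ all q xs
  all-cong-∈ []       e = refl
  all-cong-∈ (x ∷ xs) e = cong₂ _∧_ (e x (here refl)) (all-cong-∈ xs (λ y y∈xs → e y (there y∈xs)))

  all-map : ∀ {B : Set} (f : B → A) p xs → all p (L.map f xs) ≡ all (p ∘ f) xs
  all-map f p []       = refl
  all-map f p (x ∷ xs) = cong (p (f x) ∧_) (all-map f p xs)

  all-concatMap : ∀ {B : Set} (g : B → List A) p xs → all p (L.concatMap g xs) ≡ all (λ x → all p (g x)) xs
  all-concatMap g p []       = refl
  all-concatMap g p (x ∷ xs) = trans (all-++ (g x)) (cong (all p (g x) ∧_) (all-concatMap g p xs))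
    where
    all-++ : ∀ ys {zs} → all p (ys ++ zs) ≡ all p ys ∧ all p zs
    all-++ []       = refl
    all-++ (y ∷ ys) = trans (cong (p y ∧_) (all-++ ys)) (sym (∧-assoc (p y) _ _))

  all-not≡∑𝟙≡ᵇ0 : ∀ p (xs : List A) → all (not ∘ p) xs ≡ (∑[ x ∈ xs ] 𝟙 (p x) ≡ᵇ 0)
  all-not≡∑𝟙≡ᵇ0 p []       = refl
  all-not≡∑𝟙≡ᵇ0 p (x ∷ xs) with p x
  ... | true  = refl
  ... | false = all-not≡∑𝟙≡ᵇ0 p xs

≡ᵇ-refl : ∀ v → (v ≡ᵇ v) ≡ true
≡ᵇ-refl zero    = refl
≡ᵇ-refl (suc v) = ≡ᵇ-refl v

≢⇒≡ᵇ-false : ∀ {y v} → y ≢ v → (y ≡ᵇ v) ≡ false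
≢⇒≡ᵇ-false {y} {v} y≢v with y ≡ᵇ v in eq
... | true  = ⊥-elim (y≢v (≡ᵇ⇒≡ y v (≡true⇒T eq)))
... | false = refl

≡ᵇ-true⇒≡ : ∀ {y v} → (y ≡ᵇ v) ≡ true → y ≡ v
≡ᵇ-true⇒≡ {y} {v} eq = ≡ᵇ⇒≡ y v (≡true⇒T eq)

∈ᵇ-true : ∀ {y xs} → y ∈ xs → (y ∈ᵇ xs) ≡ true
∈ᵇ-true {y}          (here refl) rewrite ≡ᵇ-refl y = refl
∈ᵇ-true {y} {x ∷ xs} (there y∈xs) rewrite ∈ᵇ-true y∈xs = ∨-zeroʳ (y ≡ᵇ x)

∈ᵇ-false : ∀ {y xs} → ¬ y ∈ xs → (y ∈ᵇ xs) ≡ false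
∈ᵇ-false {y} {[]}     y∉xs = refl
∈ᵇ-false {y} {x ∷ xs} y∉xs
  rewrite ≢⇒≡ᵇ-false (λ y≡x → y∉xs (here y≡x)) = ∈ᵇ-false (λ y∈xs → y∉xs (there y∈xs))

∈ᵇ-++ : ∀ y xs ys → (y ∈ᵇ (xs ++ ys)) ≡ (y ∈ᵇ xs) ∨ (y ∈ᵇ ys)
∈ᵇ-++ y []       ys = refl
∈ᵇ-++ y (x ∷ xs) ys = trans (cong ((y ≡ᵇ x) ∨_) (∈ᵇ-++ y xs ys)) (sym (∨-assoc (y ≡ᵇ x) _ _))

∈-toList⁻ : ∀ {k y} (n : Vec ℕ k) → y ∈ V.toList n → Σ (Fin k) λ t → y ≡ lookup n t
∈-toList⁻ (x ∷ n) (here y≡x)  = fz , y≡x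
∈-toList⁻ (x ∷ n) (there y∈n) with ∈-toList⁻ n y∈n
... | t , y≡nₜ = fs t , y≡nₜ

range : ℕ → ℕ → List ℕ
range a zero    = []
range a (suc l) = a ∷ range (suc a) l

applyUpTo≡range : ∀ (f : ℕ → ℕ) a l → (∀ i → f i ≡ a + i) → L.applyUpTo f l ≡ range a l
applyUpTo≡range f a zero    e = refl
applyUpTo≡range f a (suc l) e = cong₂ _∷_ (trans (e 0) (+-identityʳ a))
  (applyUpTo≡range (f ∘ suc) (suc a) l (λ i → trans (e (suc i)) (+-suc a i)))

interval≡range : ∀ a b → interval a b ≡ range a (suc b ∸ a)
interval≡range a b =
  trans (LP.map-applyUpTo (λ i → i) (a +_) (suc b ∸ a)) (applyUpTo≡range (a +_) a _ (λ _ → refl))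

range-+ : ∀ a l₁ l₂ → range a (l₁ + l₂) ≡ range a l₁ ++ range (a + l₁) l₂
range-+ a zero     l₂ = cong (λ b → range b l₂) (sym (+-identityʳ a))
range-+ a (suc l₁) l₂ = cong (a ∷_)
  (trans (range-+ (suc a) l₁ l₂) (cong (λ b → range (suc a) l₁ ++ range b l₂) (sym (+-suc a l₁))))

∈-range⁻ : ∀ {y a l} → y ∈ range a l → a ≤ y × y < a + l
∈-range⁻ {a = a} {suc l} (here refl) = ≤-refl , m<m+n a (s≤s z≤n)
∈-range⁻ {y} {a} {suc l} (there y∈r) with ∈-range⁻ y∈r
... | a<y , y<a+l = <⇒≤ a<y , subst (y <_) (sym (+-suc a l)) y<a+l

∈-range⁺ : ∀ {y a l} → a ≤ y → y < a + l → y ∈ range a l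
∈-range⁺ {y} {a} {zero}  a≤y y<a+0 = ⊥-elim
  (<-irrefl refl (<-≤-trans y<a+0 (subst (_≤ y) (sym (+-identityʳ a)) a≤y)))
∈-range⁺ {y} {a} {suc l} a≤y y<a+l with a ≟ y
... | yes refl = here refl
... | no a≢y   = there (∈-range⁺ (≤∧≢⇒< a≤y a≢y) (subst (y <_) (+-suc a l) y<a+l))

∑-𝟙≡ᵇ-∉ : ∀ {v} (xs : List ℕ) (h : ℕ → ℕ) → ¬ v ∈ xs → ∑[ y ∈ xs ] (𝟙 (y ≡ᵇ v) * h y) ≡ 0
∑-𝟙≡ᵇ-∉ {v} xs h v∉xs = ∑-zero xs (λ y y∈xs →
  cong (λ b → 𝟙 b * h y) (≢⇒≡ᵇ-false {y} {v} (λ { refl → v∉xs y∈xs })))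

∑-𝟙≡ᵇ-range : ∀ {v} a l (h : ℕ → ℕ) → v ∈ range a l → ∑[ y ∈ range a l ] (𝟙 (y ≡ᵇ v) * h y) ≡ h v
∑-𝟙≡ᵇ-range {v} a (suc l) h (here refl) rewrite ≡ᵇ-refl v = trans
  (cong₂ _+_ (+-identityʳ (h v)) (∑-𝟙≡ᵇ-∉ (range (suc v) l) h (λ v∈r → <-irrefl refl (proj₁ (∈-range⁻ v∈r)))))
  (+-identityʳ (h v))
∑-𝟙≡ᵇ-range {v} a (suc l) h (there v∈r) rewrite ≢⇒≡ᵇ-false {a} {v}
  (λ { refl → <-irrefl refl (proj₁ (∈-range⁻ v∈r)) }) =
  ∑-𝟙≡ᵇ-range (suc a) l h v∈r

length-range : ∀ a l → L.length (range a l) ≡ l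
length-range a zero    = refl
length-range a (suc l) = cong suc (length-range (suc a) l)

∑-range-suc : ∀ a l (h : ℕ → ℕ) → ∑ (range (suc a) l) h ≡ ∑[ y ∈ range a l ] h (suc y)
∑-range-suc a zero    h = refl
∑-range-suc a (suc l) h = cong (h (suc a) +_) (∑-range-suc (suc a) l h)

∑-range-drop-last : ∀ a l (h : ℕ → ℕ) → h (a + l) ≡ 0 → ∑ (range a (suc l)) h ≡ ∑ (range a l) h
∑-range-drop-last a l h last≡0 = begin
  ∑ (range a (suc l)) h
    ≡⟨ cong (λ xs → ∑ xs h) (subst (λ l′ → range a l′ ≡ range a l ++ range (a + l) 1) (+-comm l 1) (range-+ a l 1)) ⟩
  ∑ (range a l ++ range (a + l) 1) h
    ≡⟨ ∑-++ (range a l) _ h ⟩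
  ∑ (range a l) h + (h (a + l) + 0)
    ≡⟨ cong (λ x → ∑ (range a l) h + (x + 0)) last≡0 ⟩
  ∑ (range a l) h + 0
    ≡⟨ +-identityʳ _ ⟩
  ∑ (range a l) h ∎
  where open ≡-Reasoning

<⇒≤ᵇ-false : ∀ {u v} → u < v → (v ≤ᵇ u) ≡ false
<⇒≤ᵇ-false {u} {v} u<v with v ≤ᵇ u in eq
... | true  = ⊥-elim (<-irrefl refl (<-≤-trans u<v (≤ᵇ⇒≤ v u (≡true⇒T eq))))
... | false = refl

∑-range-≤ᵇ : ∀ u N (H : ℕ → ℕ) → u ≤ N → ∑[ v ∈ range 1 N ] (𝟙 (v ≤ᵇ u) * H v) ≡ ∑ (range 1 u) H
∑-range-≤ᵇ u N H u≤N = begin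
  ∑[ v ∈ range 1 N ] (𝟙 (v ≤ᵇ u) * H v)
    ≡⟨ cong (λ l → ∑[ v ∈ range 1 l ] (𝟙 (v ≤ᵇ u) * H v)) (sym (m+[n∸m]≡n u≤N)) ⟩
  ∑[ v ∈ range 1 (u + (N ∸ u)) ] (𝟙 (v ≤ᵇ u) * H v)
    ≡⟨ trans (cong (λ xs → ∑[ v ∈ xs ] (𝟙 (v ≤ᵇ u) * H v)) (range-+ 1 u (N ∸ u))) (∑-++ (range 1 u) _ _) ⟩
  ∑[ v ∈ range 1 u ] (𝟙 (v ≤ᵇ u) * H v) + ∑[ v ∈ range (suc u) (N ∸ u) ] (𝟙 (v ≤ᵇ u) * H v)
    ≡⟨ cong₂ _+_ (∑-cong-∈ (range 1 u) below) (∑-zero (range (suc u) (N ∸ u)) above) ⟩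
  ∑ (range 1 u) H + 0
    ≡⟨ +-identityʳ _ ⟩
  ∑ (range 1 u) H ∎
  where
  open ≡-Reasoning
  below : ∀ v → v ∈ range 1 u → 𝟙 (v ≤ᵇ u) * H v ≡ H v
  below v v∈ rewrite T⇒≡true (≤⇒≤ᵇ (≤-pred (proj₂ (∈-range⁻ v∈)))) = +-identityʳ (H v)
  above : ∀ v → v ∈ range (suc u) (N ∸ u) → 𝟙 (v ≤ᵇ u) * H v ≡ 0
  above v v∈ rewrite <⇒≤ᵇ-false (proj₁ (∈-range⁻ v∈)) = refl

δ : {k : ℕ} → Fin k → Fin k → ℕ
δ fz     fz     = 1
δ fz     (fs _) = 0
δ (fs _) fz     = 0
δ (fs t) (fs s) = δ t s

δ-refl : ∀ {k} (t : Fin k) → δ t t ≡ 1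
δ-refl fz     = refl
δ-refl (fs t) = δ-refl t

δ-≢ : ∀ {k} {t s : Fin k} → t ≢ s → δ t s ≡ 0
δ-≢ {t = fz}   {fz}   t≢s = ⊥-elim (t≢s refl)
δ-≢ {t = fz}   {fs s} t≢s = refl
δ-≢ {t = fs t} {fz}   t≢s = refl
δ-≢ {t = fs t} {fs s} t≢s = δ-≢ (t≢s ∘ cong fs)

δ≤1 : ∀ {k} (t s : Fin k) → δ t s ≤ 1
δ≤1 t s with t Fin.≟ s
... | yes refl = ≤-reflexive (δ-refl t)
... | no t≢s   = subst (_≤ 1) (sym (δ-≢ t≢s)) z≤n

∑-allFin-suc : ∀ {k} (h : Fin (suc k) → ℕ) → ∑ (L.allFin (suc k)) h ≡ h fz + ∑ (L.allFin k) (h ∘ fs)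
∑-allFin-suc {k} h = cong (h fz +_)
  (trans (cong (λ xs → ∑ xs h) (sym (LP.map-tabulate (λ i → i) fs))) (∑-map fs (L.allFin k) h))

∑-δ : ∀ {k} (t : Fin k) (h : Fin k → ℕ) → ∑[ s ∈ L.allFin k ] (δ t s * h s) ≡ h t
∑-δ {suc k} fz h = trans (∑-allFin-suc (λ s → δ fz s * h s))
  (trans (cong₂ _+_ (+-identityʳ (h fz)) (∑-zero (L.allFin k) (λ _ _ → refl))) (+-identityʳ (h fz)))
∑-δ {suc k} (fs t) h = trans (∑-allFin-suc (λ s → δ (fs t) s * h s)) (∑-δ t (h ∘ fs))

allFinᵇ-suc : ∀ {k} (p : Fin (suc k) → Bool) → allFinᵇ (suc k) p ≡ p fz ∧ allFinᵇ k (p ∘ fs)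
allFinᵇ-suc {k} p = cong (p fz ∧_)
  (trans (cong (all p) (sym (LP.map-tabulate (λ i → i) fs))) (all-map fs p (L.allFin k)))

allFinᵇ⁻ : ∀ {k} (p : Fin k → Bool) → allFinᵇ k p ≡ true → ∀ j → p j ≡ true
allFinᵇ⁻ {k} p all≡true j = T⇒≡true (All.lookup (all⁺ p (L.allFin k) (≡true⇒T all≡true)) (∈-allFin j))

allFinᵇ⁺ : ∀ {k} (p : Fin k → Bool) → (∀ j → p j ≡ true) → allFinᵇ k p ≡ true
allFinᵇ⁺ p each = T⇒≡true (all⁻ p (tabulate⁺ (λ j → ≡true⇒T (each j))))

sumUpTo : {k : ℕ} → Fin k → (Fin k → ℕ) → ℕ
sumUpTo fz     h = h fz
sumUpTo (fs j) h = h fz + sumUpTo j (h ∘ fs)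

sumUpTo-cong : ∀ {k} (j : Fin k) {f g : Fin k → ℕ} → (∀ t → toℕ t ≤ toℕ j → f t ≡ g t) → sumUpTo j f ≡ sumUpTo j g
sumUpTo-cong fz     e = e fz z≤n
sumUpTo-cong (fs j) e = cong₂ _+_ (e fz z≤n) (sumUpTo-cong j (λ t t≤j → e (fs t) (s≤s t≤j)))

sumUpTo-*ʳ : ∀ {k} (j : Fin k) (h : Fin k → ℕ) c → sumUpTo j h * c ≡ sumUpTo j (λ t → h t * c)
sumUpTo-*ʳ fz     h c = refl
sumUpTo-*ʳ (fs j) h c = trans (*-distribʳ-+ c (h fz) _) (cong (h fz * c +_) (sumUpTo-*ʳ j (h ∘ fs) c))

∑-sumUpTo : ∀ {A : Set} {k} (xs : List A) (j : Fin k) (h : A → Fin k → ℕ) →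
  ∑[ x ∈ xs ] sumUpTo j (h x) ≡ sumUpTo j (λ t → ∑[ x ∈ xs ] h x t)
∑-sumUpTo xs fz     h = refl
∑-sumUpTo xs (fs j) h =
  trans (∑-+ xs (λ x → h x fz) _) (cong (∑[ x ∈ xs ] h x fz +_) (∑-sumUpTo xs j (λ x → h x ∘ fs)))

sumUpTo≢0 : ∀ {k} (j : Fin k) (h : Fin k → ℕ) → sumUpTo j h ≢ 0 → Σ (Fin k) λ t → toℕ t ≤ toℕ j × h t ≢ 0
sumUpTo≢0 fz     h ≢0 = fz , z≤n , ≢0
sumUpTo≢0 (fs j) h ≢0 with h fz ≟ 0
... | no  h0≢0 = fz , z≤n , h0≢0
... | yes h0≡0 with sumUpTo≢0 j (h ∘ fs) (λ rest≡0 → ≢0 (cong₂ _+_ h0≡0 rest≡0))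
...   | t , t≤j , ht≢0 = fs t , s≤s t≤j , ht≢0

decrementAt : ∀ {k} → Vec ℕ k → Fin k → Vec ℕ k
decrementAt (x ∷ xs) fz     = (x ∸ 1) ∷ xs
decrementAt (x ∷ xs) (fs t) = x ∷ decrementAt xs t

lookup-decrementAt : ∀ {k} (I : Vec ℕ k) t s → lookup (decrementAt I t) s ≡ lookup I s ∸ δ t s
lookup-decrementAt (x ∷ I) fz     fz     = refl
lookup-decrementAt (x ∷ I) fz     (fs s) = refl
lookup-decrementAt (x ∷ I) (fs t) fz     = refl
lookup-decrementAt (x ∷ I) (fs t) (fs s) = lookup-decrementAt I t s

decrementAt-+δ : ∀ {k} (I : Vec ℕ k) s → lookup I s ≢ 0 → ∀ i → lookup I i ≡ δ s i + lookup (decrementAt I s) i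
decrementAt-+δ I s Is≢0 i rewrite lookup-decrementAt I s i with s Fin.≟ i
... | yes refl rewrite δ-refl s = sym (m+[n∸m]≡n (n≢0⇒n>0 Is≢0))
... | no s≢i   rewrite δ-≢ s≢i  = refl

isZeroVec-lookup : ∀ {k} (I : Vec ℕ k) → isZeroVec I ≡ true → ∀ t → lookup I t ≡ 0
isZeroVec-lookup (zero  ∷ I) eq fz     = refl
isZeroVec-lookup (zero  ∷ I) eq (fs t) = isZeroVec-lookup I eq t

isZeroVec≡allFinᵇ : ∀ {k} (I : Vec ℕ k) → isZeroVec I ≡ allFinᵇ k (λ t → lookup I t ≡ᵇ 0)
isZeroVec≡allFinᵇ []      = refl
isZeroVec≡allFinᵇ (x ∷ I) =
  trans (cong ((x ≡ᵇ 0) ∧_) (isZeroVec≡allFinᵇ I)) (sym (allFinᵇ-suc (λ t → lookup (x ∷ I) t ≡ᵇ 0)))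

isZeroVec⁺ : ∀ {k} (I : Vec ℕ k) → (∀ i → lookup I i ≡ 0) → isZeroVec I ≡ true
isZeroVec⁺ I entries≡0 = trans (isZeroVec≡allFinᵇ I) (allFinᵇ⁺ _ (λ i → cong (_≡ᵇ 0) (entries≡0 i)))

if-then-0 : ∀ b x → (if b then x else 0) ≡ x * 𝟙 b
if-then-0 true  x = sym (*-identityʳ x)
if-then-0 false x = sym (*-zeroʳ x)

sufSum-cong : ∀ {k} (v w : Vec ℕ k) → (∀ i → lookup v i ≡ lookup w i) → ∀ t → sufSum v t ≡ sufSum w t
sufSum-cong v w e t = ∑-cong (L.allFin _) (λ i → cong (λ x → if toℕ t ≤ᵇ toℕ i then x else 0) (e i))

sufSum-zero : ∀ {k} (v : Vec ℕ k) → (∀ i → lookup v i ≡ 0) → ∀ t → sufSum v t ≡ 0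
sufSum-zero v e t = ∑-zero (L.allFin _) (λ i _ → trans (if-then-0 _ (lookup v i)) (cong (_* _) (e i)))

sufSum-δ+ : ∀ {k} (v w : Vec ℕ k) s → (∀ i → lookup v i ≡ δ s i + lookup w i) →
  ∀ t → sufSum v t ≡ 𝟙 (toℕ t ≤ᵇ toℕ s) + sufSum w t
sufSum-δ+ {k} v w s e t = begin
  ∑[ i ∈ L.allFin k ] (if b i then lookup v i else 0)
    ≡⟨ ∑-cong (L.allFin k) (λ i → trans (cong (λ x → if b i then x else 0) (e i)) (split (b i) (δ s i) _)) ⟩
  ∑[ i ∈ L.allFin k ] ((δ s i * 𝟙 (b i)) + (if b i then lookup w i else 0))
    ≡⟨ ∑-+ (L.allFin k) (λ i → δ s i * 𝟙 (b i)) _ ⟩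
  ∑[ i ∈ L.allFin k ] (δ s i * 𝟙 (b i)) + sufSum w t
    ≡⟨ cong (_+ sufSum w t) (∑-δ s (𝟙 ∘ b)) ⟩
  𝟙 (b s) + sufSum w t ∎
  where
  open ≡-Reasoning
  b : Fin k → Bool
  b i = toℕ t ≤ᵇ toℕ i
  split : ∀ c x y → (if c then x + y else 0) ≡ x * 𝟙 c + (if c then y else 0)
  split true  x y = cong (_+ y) (sym (*-identityʳ x))
  split false x y = sym (trans (+-identityʳ (x * 0)) (*-zeroʳ x))

𝟙≤ᵇ-mono : ∀ {k} (t s j : Fin k) → toℕ s ≤ toℕ j → 𝟙 (toℕ t ≤ᵇ toℕ s) ≤ 𝟙 (toℕ t ≤ᵇ toℕ j)
𝟙≤ᵇ-mono t s j s≤j with toℕ t ≤ᵇ toℕ s in eq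
... | false = z≤n
... | true rewrite T⇒≡true (≤⇒≤ᵇ (≤-trans (≤ᵇ⇒≤ (toℕ t) (toℕ s) (≡true⇒T eq)) s≤j)) = ≤-refl

-- The coefficients φ

-- φ js I counts the maps x ↦ f x ≤ n_(js x) whose image meets the t-th gap in a given set of
-- I_t points (countMaps≡φ): the first point is either a marker n_t, t ≤ j, or one of the I_t
-- given points of a gap t ≤ j, which the remaining points may or may not hit again.
φ : ∀ {k m} → Vec (Fin k) m → Vec ℕ k → ℕ
φ []       I = 𝟙 (isZeroVec I)
φ (j ∷ js) I = sumUpTo j (λ t → suc (lookup I t) * φ js I + lookup I t * φ js (decrementAt I t))

φ-∷≢0 : ∀ {k m} (j : Fin k) (js : Vec (Fin k) m) I → φ (j ∷ js) I ≢ 0 →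
  φ js I ≢ 0 ⊎ Σ (Fin k) λ s → toℕ s ≤ toℕ j × lookup I s ≢ 0 × φ js (decrementAt I s) ≢ 0
φ-∷≢0 j js I ≢0 with φ js I ≟ 0
... | no φ≢0 = inj₁ φ≢0
... | yes φ≡0 with sumUpTo≢0 j _ ≢0
...   | s , s≤j , term≢0 = inj₂ (s , s≤j , Is≢0 , φ′≢0)
  where
  φ′ = φ js (decrementAt I s)
  shifted≢0 : lookup I s * φ′ ≢ 0
  shifted≢0 e = term≢0 (cong₂ _+_ (trans (cong (suc (lookup I s) *_) φ≡0) (*-zeroʳ (suc (lookup I s)))) e)
  Is≢0 : lookup I s ≢ 0
  Is≢0 e = shifted≢0 (cong (_* φ′) e)
  φ′≢0 : φ′ ≢ 0
  φ′≢0 e = shifted≢0 (trans (cong (lookup I s *_) e) (*-zeroʳ (lookup I s)))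

φ[]≢0⇒zero : ∀ {k} (I : Vec ℕ k) → φ [] I ≢ 0 → ∀ t → lookup I t ≡ 0
φ[]≢0⇒zero I ≢0 with isZeroVec I in eq
... | true  = isZeroVec-lookup I eq
... | false = ⊥-elim (≢0 refl)

φ≢0⇒≤length : ∀ {k m} (js : Vec (Fin k) m) I → φ js I ≢ 0 → ∀ t → lookup I t ≤ m
φ≢0⇒≤length []       I ≢0 t = ≤-reflexive (φ[]≢0⇒zero I ≢0 t)
φ≢0⇒≤length (j ∷ js) I ≢0 t with φ-∷≢0 j js I ≢0
... | inj₁ φ≢0 = m≤n⇒m≤1+n (φ≢0⇒≤length js I φ≢0 t)
... | inj₂ (s , _ , _ , φ′≢0) = ≤-trans (m≤n+m∸n (lookup I t) (δ s t))
  (+-mono-≤ (δ≤1 s t) (subst (_≤ _) (lookup-decrementAt I s t) (φ≢0⇒≤length js (decrementAt I s) φ′≢0 t)))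

φ-length-zero : ∀ {k m} (js : Vec (Fin k) m) I → m ≡ 0 → φ js I ≡ 𝟙 (isZeroVec I)
φ-length-zero [] I _ = refl

occurrences : ∀ {k m} → Vec (Fin k) m → Fin k → ℕ
occurrences []       i = 0
occurrences (j ∷ js) i = δ j i + occurrences js i

φ≢0⇒dominated : ∀ {k m} (js : Vec (Fin k) m) I → φ js I ≢ 0 →
  ∀ t → sufSum I t ≤ sufSum (V.tabulate (occurrences js)) t
φ≢0⇒dominated []       I ≢0 t = subst (_≤ _) (sym (sufSum-zero I (φ[]≢0⇒zero I ≢0) t)) z≤n
φ≢0⇒dominated (j ∷ js) I ≢0 t = ≤-trans (bound (φ-∷≢0 j js I ≢0)) (≤-reflexive (sym occurrences-∷))
  where
  open ≤-Reasoning
  rest = sufSum (V.tabulate (occurrences js)) t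
  occurrences-∷ : sufSum (V.tabulate (occurrences (j ∷ js))) t ≡ 𝟙 (toℕ t ≤ᵇ toℕ j) + rest
  occurrences-∷ = sufSum-δ+ (V.tabulate (occurrences (j ∷ js))) (V.tabulate (occurrences js)) j
    (λ i → trans (VP.lookup∘tabulate (occurrences (j ∷ js)) i)
    (cong (δ j i +_) (sym (VP.lookup∘tabulate (occurrences js) i)))) t
  bound : (φ js I ≢ 0 ⊎ Σ (Fin _) λ s → toℕ s ≤ toℕ j × lookup I s ≢ 0 × φ js (decrementAt I s) ≢ 0) →
    sufSum I t ≤ 𝟙 (toℕ t ≤ᵇ toℕ j) + rest
  bound (inj₁ φ≢0) = ≤-trans (φ≢0⇒dominated js I φ≢0 t) (m≤n+m rest _)
  bound (inj₂ (s , s≤j , Is≢0 , φ′≢0)) = begin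
    sufSum I t                                     ≡⟨ sufSum-δ+ I (decrementAt I s) s (decrementAt-+δ I s Is≢0) t ⟩
    𝟙 (toℕ t ≤ᵇ toℕ s) + sufSum (decrementAt I s) t ≤⟨ +-mono-≤ (𝟙≤ᵇ-mono t s j s≤j) (φ≢0⇒dominated js _ φ′≢0 t) ⟩
    𝟙 (toℕ t ≤ᵇ toℕ j) + rest                     ∎

-- Expansion of a product of the n_j

absorption : ∀ g v → suc v * (g C suc v) + v * (g C v) ≡ g * (g C v)
absorption zero    zero    = refl
absorption zero    (suc v) rewrite k>n⇒nCk≡0 {0} {suc (suc v)} (s≤s z≤n) | k>n⇒nCk≡0 {0} {suc v} (s≤s z≤n)
  = cong₂ _+_ (*-zeroʳ (suc (suc v))) (*-zeroʳ (suc v))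
absorption (suc g) zero    = trans (+-identityʳ _)
  (trans (*-identityˡ _) (trans (nC1≡n (suc g)) (sym (*-identityʳ (suc g)))))
absorption (suc g) (suc v) = begin
  suc (suc v) * (suc g C suc (suc v)) + suc v * (suc g C suc v)
    ≡⟨ sym (cong₂ (λ x y → suc (suc v) * x + suc v * y) (pascal g (suc v)) (pascal g v)) ⟩
  suc (suc v) * (b₁ + b₂) + suc v * (b₀ + b₁)
    ≡⟨ regroup v b₀ b₁ b₂ ⟩
  (suc (suc v) * b₂ + suc v * b₁) + ((suc v * b₁ + v * b₀) + (b₀ + b₁))
    ≡⟨ cong₂ (λ x y → x + (y + (b₀ + b₁))) (absorption g (suc v)) (absorption g v) ⟩
  g * b₁ + (g * b₀ + (b₀ + b₁))
    ≡⟨ collect g b₀ b₁ ⟩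
  suc g * (b₀ + b₁)
    ≡⟨ cong (suc g *_) (pascal g v) ⟩
  suc g * (suc g C suc v) ∎
  where
  open ≡-Reasoning
  pascal = nCk+nC[k+1]≡[n+1]C[k+1]
  b₀ = g C v
  b₁ = g C suc v
  b₂ = g C suc (suc v)
  regroup : ∀ v a b c → suc (suc v) * (b + c) + suc v * (a + b) ≡
    (suc (suc v) * c + suc v * b) + ((suc v * b + v * a) + (a + b))
  regroup = solve-∀
  collect : ∀ g a b → g * b + (g * a + (a + b)) ≡ suc g * (a + b)
  collect = solve-∀

shift-1D : ∀ g M (a : ℕ → ℕ) → a M ≡ 0 →
  ∑[ v ∈ range 0 (suc M) ] (v * ((g C v) * a (v ∸ 1))) + ∑[ v ∈ range 0 (suc M) ] (v * ((g C v) * a v))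
    ≡ ∑[ v ∈ range 0 (suc M) ] (g * ((g C v) * a v))
shift-1D g M a aM≡0 = begin
  ∑[ v ∈ range 1 M ] (v * ((g C v) * a (v ∸ 1))) + ∑[ v ∈ range 0 (suc M) ] (v * ((g C v) * a v))
    ≡⟨ cong₂ _+_ (∑-range-suc 0 M _) (∑-range-drop-last 0 M _ (vanishes M)) ⟩
  ∑[ v ∈ range 0 M ] (suc v * ((g C suc v) * a v)) + ∑[ v ∈ range 0 M ] (v * ((g C v) * a v))
    ≡⟨ sym (∑-+ (range 0 M) _ _) ⟩
  ∑[ v ∈ range 0 M ] (suc v * ((g C suc v) * a v) + v * ((g C v) * a v))
    ≡⟨ ∑-cong (range 0 M) (λ v → trans (factor (suc v) (g C suc v) v (g C v) (a v))
                                        (trans (cong (_* a v) (absorption g v)) (*-assoc g (g C v) (a v)))) ⟩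
  ∑[ v ∈ range 0 M ] (g * ((g C v) * a v))
    ≡⟨ sym (∑-range-drop-last 0 M _ (vanishes g)) ⟩
  ∑[ v ∈ range 0 (suc M) ] (g * ((g C v) * a v)) ∎
  where
  open ≡-Reasoning
  vanishes : ∀ x → x * ((g C M) * a M) ≡ 0
  vanishes x rewrite aM≡0 | *-zeroʳ (g C M) = *-zeroʳ x
  factor : ∀ x c y d a → x * (c * a) + y * (d * a) ≡ (x * c + y * d) * a
  factor = solve-∀

box : ∀ k → ℕ → List (Vec ℕ k)
box k M = allVecs k (interval 0 M)

binomials : ∀ {k} → Vec ℕ k → Vec ℕ k → ℕ
binomials g I = V.foldr _ _*_ 1 (V.zipWith _C_ g I)

binomials-zero : ∀ {k} (g : Vec ℕ k) → binomials g (V.replicate k 0) ≡ 1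
binomials-zero []      = refl
binomials-zero (x ∷ g) = trans (+-identityʳ _) (binomials-zero g)

binomials-tabulate : ∀ {k} (h : Fin k → ℕ) (I : Vec ℕ k) →
  V.foldr _ _*_ 1 (V.tabulate (λ j → h j C lookup I j)) ≡ binomials (V.tabulate h) I
binomials-tabulate h []      = refl
binomials-tabulate h (i ∷ I) = cong ((h fz C i) *_) (binomials-tabulate (h ∘ fs) I)

∑-allVecs-suc : ∀ m vals (F : Vec ℕ (suc m) → ℕ) →
  ∑ (allVecs (suc m) vals) F ≡ ∑[ v ∈ vals ] ∑[ w ∈ allVecs m vals ] F (v ∷ w)
∑-allVecs-suc m vals F =
  trans (∑-concatMap _ vals F) (∑-cong vals (λ v → ∑-map (v ∷_) (allVecs m vals) F))

∑-box-suc : ∀ k M (F : Vec ℕ (suc k) → ℕ) →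
  ∑ (box (suc k) M) F ≡ ∑[ v ∈ range 0 (suc M) ] ∑[ w ∈ box k M ] F (v ∷ w)
∑-box-suc k M F = trans (∑-allVecs-suc k (interval 0 M) F)
  (cong (λ xs → ∑[ v ∈ xs ] ∑[ w ∈ box k M ] F (v ∷ w)) (interval≡range 0 M))

∑-box-zero : ∀ k M (F : Vec ℕ k → ℕ) → ∑[ I ∈ box k M ] (𝟙 (isZeroVec I) * F I) ≡ F (V.replicate k 0)
∑-box-zero zero    M F = trans (+-identityʳ _) (+-identityʳ (F []))
∑-box-zero (suc k) M F = begin
  ∑[ I ∈ box (suc k) M ] (𝟙 (isZeroVec I) * F I)
    ≡⟨ ∑-box-suc k M _ ⟩
  ∑[ v ∈ range 0 (suc M) ] ∑[ w ∈ box k M ] (𝟙 ((v ≡ᵇ 0) ∧ isZeroVec w) * F (v ∷ w))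
    ≡⟨ ∑-cong (range 0 (suc M)) (λ v → trans (∑-cong (box k M) (λ w → trans (cong (_* F (v ∷ w)) (𝟙-∧ (v ≡ᵇ 0) _))
                                                                              (*-assoc (𝟙 (v ≡ᵇ 0)) _ _)))
                                     (trans (∑-*ˡ (box k M) (𝟙 (v ≡ᵇ 0)) _)
                                         (cong (𝟙 (v ≡ᵇ 0) *_) (∑-box-zero k M _)))) ⟩
  ∑[ v ∈ range 0 (suc M) ] (𝟙 (v ≡ᵇ 0) * F (v ∷ V.replicate k 0))
    ≡⟨ ∑-𝟙≡ᵇ-range 0 (suc M) _ (here refl) ⟩
  F (V.replicate (suc k) 0) ∎
  where open ≡-Reasoning

-- summation by parts in coordinate t, by absorption; F vanishing on the face I_t = M keeps the
-- shifted index inside the box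
∑-box-shift : ∀ k M (g : Vec ℕ k) (t : Fin k) (F : Vec ℕ k → ℕ) → (∀ I → lookup I t ≡ M → F I ≡ 0) →
  ∑[ I ∈ box k M ] (lookup I t * (F (decrementAt I t) * binomials g I))
    + ∑[ I ∈ box k M ] (lookup I t * (F I * binomials g I))
  ≡ ∑[ I ∈ box k M ] (lookup g t * (F I * binomials g I))
∑-box-shift (suc k) M (g₀ ∷ g) fz F top≡0 = begin
  ∑ (box (suc k) M) X + ∑ (box (suc k) M) Y
    ≡⟨ cong₂ _+_ (trans (∑-box-suc k M X) (∑-comm R B _)) (trans (∑-box-suc k M Y) (∑-comm R B _)) ⟩
  ∑[ w ∈ B ] ∑[ v ∈ R ] X (v ∷ w) + ∑[ w ∈ B ] ∑[ v ∈ R ] Y (v ∷ w)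
    ≡⟨ sym (∑-+ B (λ w → ∑[ v ∈ R ] X (v ∷ w)) (λ w → ∑[ v ∈ R ] Y (v ∷ w))) ⟩
  ∑[ w ∈ B ] (∑[ v ∈ R ] X (v ∷ w) + ∑[ v ∈ R ] Y (v ∷ w))
    ≡⟨ ∑-cong B slice ⟩
  ∑[ w ∈ B ] ∑[ v ∈ R ] Z (v ∷ w)
    ≡⟨ sym (trans (∑-box-suc k M Z) (∑-comm R B _)) ⟩
  ∑ (box (suc k) M) Z ∎
  where
  open ≡-Reasoning
  R = range 0 (suc M)
  B = box k M
  X Y Z : Vec ℕ (suc k) → ℕ
  X I = lookup I fz * (F (decrementAt I fz) * binomials (g₀ ∷ g) I)
  Y I = lookup I fz * (F I * binomials (g₀ ∷ g) I)
  Z I = g₀ * (F I * binomials (g₀ ∷ g) I)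
  swap : ∀ x f c b → x * (f * (c * b)) ≡ x * (c * (f * b))
  swap x f c b = cong (x *_) (x∙yz≈y∙xz f c b)
  slice : ∀ w → ∑[ v ∈ R ] X (v ∷ w) + ∑[ v ∈ R ] Y (v ∷ w) ≡ ∑[ v ∈ R ] Z (v ∷ w)
  slice w = trans (cong₂ _+_ (∑-cong R (λ v → swap v (F ((v ∸ 1) ∷ w)) (g₀ C v) (binomials g w)))
                             (∑-cong R (λ v → swap v (F (v ∷ w)) (g₀ C v) (binomials g w))))
    (trans (shift-1D g₀ M (λ v → F (v ∷ w) * binomials g w) (cong (_* binomials g w) (top≡0 (M ∷ w) refl)))
           (sym (∑-cong R (λ v → swap g₀ (F (v ∷ w)) (g₀ C v) (binomials g w)))))
∑-box-shift (suc k) M (g₀ ∷ g) (fs t) F top≡0 = begin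
  ∑ (box (suc k) M) X + ∑ (box (suc k) M) Y
    ≡⟨ cong₂ _+_ (∑-box-suc k M X) (∑-box-suc k M Y) ⟩
  ∑[ v ∈ R ] ∑[ w ∈ B ] X (v ∷ w) + ∑[ v ∈ R ] ∑[ w ∈ B ] Y (v ∷ w)
    ≡⟨ sym (∑-+ R (λ v → ∑[ w ∈ B ] X (v ∷ w)) (λ v → ∑[ w ∈ B ] Y (v ∷ w))) ⟩
  ∑[ v ∈ R ] (∑[ w ∈ B ] X (v ∷ w) + ∑[ w ∈ B ] Y (v ∷ w))
    ≡⟨ ∑-cong R slice ⟩
  ∑[ v ∈ R ] ∑[ w ∈ B ] Z (v ∷ w)
    ≡⟨ sym (∑-box-suc k M Z) ⟩
  ∑ (box (suc k) M) Z ∎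
  where
  open ≡-Reasoning
  R = range 0 (suc M)
  B = box k M
  X Y Z : Vec ℕ (suc k) → ℕ
  X I = lookup I (fs t) * (F (decrementAt I (fs t)) * binomials (g₀ ∷ g) I)
  Y I = lookup I (fs t) * (F I * binomials (g₀ ∷ g) I)
  Z I = lookup g t * (F I * binomials (g₀ ∷ g) I)
  pull : ∀ c (x f b : Vec ℕ k → ℕ) → ∑[ w ∈ B ] (x w * (f w * (c * b w))) ≡ c * ∑[ w ∈ B ] (x w * (f w * b w))
  pull c x f b = trans (∑-cong B (λ w → trans (cong (x w *_) (x∙yz≈y∙xz (f w) c (b w))) (x∙yz≈y∙xz (x w) c _)))
                       (∑-*ˡ B c _)
  slice : ∀ v → ∑[ w ∈ B ] X (v ∷ w) + ∑[ w ∈ B ] Y (v ∷ w) ≡ ∑[ w ∈ B ] Z (v ∷ w)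
  slice v = begin
    ∑[ w ∈ B ] X (v ∷ w) + ∑[ w ∈ B ] Y (v ∷ w)
      ≡⟨ cong₂ _+_ (pull g₀Cv (λ w → lookup w t) (λ w → F (v ∷ decrementAt w t)) (binomials g))
                   (pull g₀Cv (λ w → lookup w t) (λ w → F (v ∷ w)) (binomials g)) ⟩
    g₀Cv * ∑[ w ∈ B ] (lookup w t * (F (v ∷ decrementAt w t) * binomials g w))
      + g₀Cv * ∑[ w ∈ B ] (lookup w t * (F (v ∷ w) * binomials g w))
      ≡⟨ trans (sym (*-distribˡ-+ g₀Cv _ _))
          (cong (g₀Cv *_) (∑-box-shift k M g t (λ w → F (v ∷ w)) (λ w → top≡0 (v ∷ w)))) ⟩
    g₀Cv * ∑[ w ∈ B ] (lookup g t * (F (v ∷ w) * binomials g w))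
      ≡⟨ sym (pull g₀Cv (λ _ → lookup g t) (λ w → F (v ∷ w)) (binomials g)) ⟩
    ∑[ w ∈ B ] Z (v ∷ w) ∎
    where g₀Cv = g₀ C v

prodAt : ∀ {k m} → Vec ℕ k → Vec (Fin k) m → ℕ
prodAt n []       = 1
prodAt n (j ∷ js) = lookup n j * prodAt n js

expansion : ∀ {k} (n g : Vec ℕ k) → (∀ j → sumUpTo j (λ t → suc (lookup g t)) ≡ lookup n j) →
  ∀ {m} (js : Vec (Fin k) m) M → m ≤ M → prodAt n js ≡ ∑[ I ∈ box k M ] (φ js I * binomials g I)
expansion {k} n g n≡ []           M _   = sym (trans (∑-box-zero k M (binomials g)) (binomials-zero g))
expansion {k} n g n≡ {suc m} (j ∷ js) M m<M = sym (begin
  ∑[ I ∈ B ] (φ (j ∷ js) I * binomials g I)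
    ≡⟨ ∑-cong B (λ I → sumUpTo-*ʳ j _ (binomials g I)) ⟩
  ∑[ I ∈ B ] sumUpTo j (λ t → term t I)
    ≡⟨ ∑-sumUpTo B j (λ I t → term t I) ⟩
  sumUpTo j (λ t → ∑[ I ∈ B ] term t I)
    ≡⟨ sumUpTo-cong j (λ t _ → ∑-term t) ⟩
  sumUpTo j (λ t → suc (lookup g t) * S)
    ≡⟨ sym (sumUpTo-*ʳ j _ S) ⟩
  sumUpTo j (λ t → suc (lookup g t)) * S
    ≡⟨ cong₂ _*_ (n≡ j) (sym (expansion n g n≡ js M (≤-trans (n≤1+n m) m<M))) ⟩
  lookup n j * prodAt n js ∎)
  where
  open ≡-Reasoning
  B = box k M
  S = ∑[ I ∈ B ] (φ js I * binomials g I)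
  term : Fin k → Vec ℕ k → ℕ
  term t I = (suc (lookup I t) * φ js I + lookup I t * φ js (decrementAt I t)) * binomials g I
  top≡0 : ∀ t I → lookup I t ≡ M → φ js I ≡ 0
  top≡0 t I It≡M with φ js I ≟ 0
  ... | yes φ≡0 = φ≡0
  ... | no  φ≢0 = ⊥-elim (<-irrefl refl (≤-trans (s≤s (subst (_≤ m) It≡M (φ≢0⇒≤length js I φ≢0 t))) m<M))
  spread : ∀ x p q b → (suc x * p + x * q) * b ≡ p * b + (x * (q * b) + x * (p * b))
  spread = solve-∀
  ∑-term : ∀ t → ∑[ I ∈ B ] term t I ≡ suc (lookup g t) * S
  ∑-term t = begin
    ∑[ I ∈ B ] term t I
      ≡⟨ ∑-cong B (λ I → spread (lookup I t) (φ js I) (φ js (decrementAt I t)) (binomials g I)) ⟩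
    ∑[ I ∈ B ] (φ js I * binomials g I
                  + (lookup I t * (φ js (decrementAt I t) * binomials g I) + lookup I t * (φ js I * binomials g I)))
      ≡⟨ trans (∑-+ B _ _) (cong (S +_) (∑-+ B _ _)) ⟩
    S + (∑[ I ∈ B ] (lookup I t * (φ js (decrementAt I t) * binomials g I))
           + ∑[ I ∈ B ] (lookup I t * (φ js I * binomials g I)))
      ≡⟨ cong (S +_) (trans (∑-box-shift k M g t (φ js) (top≡0 t)) (∑-*ˡ B (lookup g t) _)) ⟩
    S + lookup g t * S ∎

Ascending : ∀ {k} → ℕ → Vec ℕ k → Set
Ascending a []      = ⊤
Ascending a (m ∷ n) = a < m × Ascending m n

prev : ∀ {k} → ℕ → Vec ℕ k → Fin k → ℕ
prev a n t = lookup (a ∷ n) (inject₁ t)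

ascending : ∀ {k} a (n : Vec ℕ k) → (∀ j → prev a n j < lookup n j) → Ascending a n
ascending a []      _    = _
ascending a (m ∷ n) prev< = prev< fz , ascending m n (prev< ∘ fs)

asc-prev< : ∀ {k a} {n : Vec ℕ k} → Ascending a n → ∀ j → prev a n j < lookup n j
asc-prev< {n = m ∷ n} (a<m , asc) fz     = a<m
asc-prev< {n = m ∷ n} (a<m , asc) (fs j) = asc-prev< asc j

asc-base< : ∀ {k a} {n : Vec ℕ k} → Ascending a n → ∀ j → a < lookup n j
asc-base< {n = m ∷ n} (a<m , asc) fz     = a<m
asc-base< {n = m ∷ n} (a<m , asc) (fs j) = <-trans a<m (asc-base< asc j)

asc-base≤prev : ∀ {k a} {n : Vec ℕ k} → Ascending a n → ∀ j → a ≤ prev a n j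
asc-base≤prev {n = m ∷ n} (a<m , asc) fz     = ≤-refl
asc-base≤prev {n = m ∷ n} (a<m , asc) (fs j) = ≤-trans (<⇒≤ a<m) (asc-base≤prev asc j)

asc-mono : ∀ {k a} {n : Vec ℕ k} → Ascending a n → ∀ j j′ → toℕ j ≤ toℕ j′ → lookup n j ≤ lookup n j′
asc-mono {n = m ∷ n} (a<m , asc) fz     fz      _         = ≤-refl
asc-mono {n = m ∷ n} (a<m , asc) fz     (fs j′) _         = <⇒≤ (asc-base< asc j′)
asc-mono {n = m ∷ n} (a<m , asc) (fs j) (fs j′) (s≤s j≤j′) = asc-mono asc j j′ j≤j′

asc-≤prev : ∀ {k a} {n : Vec ℕ k} → Ascending a n → ∀ t t′ → toℕ t < toℕ t′ → lookup n t ≤ prev a n t′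
asc-≤prev {n = m ∷ n} (a<m , asc) fz     (fs t′) _         = asc-base≤prev asc t′
asc-≤prev {n = m ∷ n} (a<m , asc) (fs t) (fs t′) (s≤s t<t′) = asc-≤prev asc t t′ t<t′

asc-≤top : ∀ {k a} {n : Vec ℕ k} → Ascending a n → ∀ j → lookup n j ≤ lookup (a ∷ n) (fromℕ k)
asc-≤top {n = m ∷ []}     (a<m , asc) fz     = ≤-refl
asc-≤top {n = m ∷ m′ ∷ n} (a<m , asc) fz     = <⇒≤ (asc-base< asc (fromℕ _))
asc-≤top {n = m ∷ n}      (a<m , asc) (fs j) = asc-≤top asc j

suc+∸∸1 : ∀ a m → a < m → suc a + (m ∸ a ∸ 1) ≡ m
suc+∸∸1 a m a<m = trans (sym (+-suc a (m ∸ a ∸ 1)))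
  (trans (cong (a +_) (trans (+-comm 1 _) (m∸n+n≡m (m<n⇒0<n∸m a<m)))) (m+[n∸m]≡n (<⇒≤ a<m)))

∑-range-layout : ∀ {k} a (n : Vec ℕ k) → Ascending a n → ∀ j (H : ℕ → ℕ) →
  ∑ (range (suc a) (lookup n j ∸ a)) H
    ≡ sumUpTo j (λ t → ∑ (range (suc (prev a n t)) (lookup n t ∸ prev a n t ∸ 1)) H + H (lookup n t))
∑-range-layout a (m ∷ n) (a<m , asc) fz H = begin
  ∑ (range (suc a) (m ∸ a)) H
    ≡⟨ cong (λ l → ∑ (range (suc a) l) H) (sym (m∸n+n≡m {m ∸ a} {1} (m<n⇒0<n∸m a<m))) ⟩
  ∑ (range (suc a) (m ∸ a ∸ 1 + 1)) H
    ≡⟨ cong (λ xs → ∑ xs H) (range-+ (suc a) (m ∸ a ∸ 1) 1) ⟩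
  ∑ (range (suc a) (m ∸ a ∸ 1) ++ range (suc a + (m ∸ a ∸ 1)) 1) H
    ≡⟨ ∑-++ (range (suc a) (m ∸ a ∸ 1)) _ H ⟩
  ∑ (range (suc a) (m ∸ a ∸ 1)) H + (H (suc a + (m ∸ a ∸ 1)) + 0)
    ≡⟨ cong (λ x → ∑ (range (suc a) (m ∸ a ∸ 1)) H + x) (trans (+-identityʳ _) (cong H (suc+∸∸1 a m a<m))) ⟩
  ∑ (range (suc a) (m ∸ a ∸ 1)) H + H m ∎
  where open ≡-Reasoning
∑-range-layout a (m ∷ n) (a<m , asc) (fs j) H = begin
  ∑ (range (suc a) (lookup n j ∸ a)) H
    ≡⟨ cong (λ l → ∑ (range (suc a) l) H) split-length ⟩
  ∑ (range (suc a) ((m ∸ a) + (lookup n j ∸ m))) H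
    ≡⟨ trans (cong (λ xs → ∑ xs H) (range-+ (suc a) (m ∸ a) _)) (∑-++ (range (suc a) (m ∸ a)) _ H) ⟩
  ∑ (range (suc a) (m ∸ a)) H + ∑ (range (suc a + (m ∸ a)) (lookup n j ∸ m)) H
    ≡⟨ cong₂ _+_ (∑-range-layout a (m ∷ n) (a<m , asc) fz H)
                 (trans (cong (λ b → ∑ (range (suc b) (lookup n j ∸ m)) H) (m+[n∸m]≡n (<⇒≤ a<m)))
                        (∑-range-layout m n asc j H)) ⟩
  sumUpTo (fs j) (λ t → ∑ (range (suc (prev a (m ∷ n) t)) (lookup (m ∷ n) t ∸ prev a (m ∷ n) t ∸ 1)) H
                          + H (lookup (m ∷ n) t)) ∎
  where
  open ≡-Reasoning
  m≤nⱼ = <⇒≤ (asc-base< asc j)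
  split-length : lookup n j ∸ a ≡ (m ∸ a) + (lookup n j ∸ m)
  split-length = +-cancelˡ-≡ a _ _ (trans (m+[n∸m]≡n (≤-trans (<⇒≤ a<m) m≤nⱼ))
    (sym (trans (sym (+-assoc a (m ∸ a) _))
        (trans (cong (_+ (lookup n j ∸ m)) (m+[n∸m]≡n (<⇒≤ a<m))) (m+[n∸m]≡n m≤nⱼ)))))

sumUpTo-gaps : ∀ {k} a (n : Vec ℕ k) → Ascending a n →
  ∀ j → a + sumUpTo j (λ t → suc (lookup n t ∸ prev a n t ∸ 1)) ≡ lookup n j
sumUpTo-gaps a (m ∷ n) (a<m , asc) fz     = trans (+-suc a _) (suc+∸∸1 a m a<m)
sumUpTo-gaps a (m ∷ n) (a<m , asc) (fs j) = trans (sym (+-assoc a (suc (m ∸ a ∸ 1)) rest))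
  (trans (cong (_+ rest) (trans (+-suc a _) (suc+∸∸1 a m a<m))) (sumUpTo-gaps m n asc j))
  where rest = sumUpTo j (λ t → suc (lookup n t ∸ prev m n t ∸ 1))

gapLength : ∀ {k} → Vec ℕ k → Fin k → ℕ
gapLength n t = nAt n t ∸ nBefore n t ∸ 1

gap≡range : ∀ {k} (n : Vec ℕ k) t → gap n t ≡ range (suc (nBefore n t)) (gapLength n t)
gap≡range n t = trans (interval≡range (suc (nBefore n t)) (nAt n t ∸ 1))
  (cong (range _) (trans (∸-+-assoc (nAt n t) 1 nb)
      (trans (cong (nAt n t ∸_) (+-comm 1 nb)) (sym (∸-+-assoc (nAt n t) nb 1)))))
  where nb = nBefore n t

-- Counting maps by their image on the gaps

_without_ : (ℕ → Bool) → ℕ → ℕ → Bool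
(r without v) y = if y ≡ᵇ v then false else r y

Agrees : List ℕ → (ℕ → Bool) → List ℕ → Bool
Agrees L r X = all (λ y → (y ∈ᵇ X) ==ᵇ r y) L

all-pick : ∀ (p : ℕ → Bool) v L → all p L ≡ ((v ∈ᵇ L) ⇒ᵇ p v) ∧ all (λ y → (y ≡ᵇ v) ∨ p y) L
all-pick p v []      = refl
all-pick p v (y ∷ L) with y ≟ v
... | yes refl rewrite ≡ᵇ-refl y | all-pick p y L with p y
...   | true  = cong (_∧ all (λ z → (z ≡ᵇ y) ∨ p z) L) (∨-zeroʳ (not (y ∈ᵇ L)))
...   | false = refl
all-pick p v (y ∷ L) | no y≢v
  rewrite ≢⇒≡ᵇ-false y≢v | ≢⇒≡ᵇ-false (y≢v ∘ sym) | all-pick p v L with p y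
...   | true  = refl
...   | false = sym (∧-zeroʳ _)

module _ (L : List ℕ) (r : ℕ → Bool) (v : ℕ) (X : List ℕ) where

  private
    away : Bool
    away = all (λ y → (y ≡ᵇ v) ∨ ((y ∈ᵇ X) ==ᵇ r y)) L

    Agrees-split : Agrees L r X ≡ ((v ∈ᵇ L) ⇒ᵇ ((v ∈ᵇ X) ==ᵇ r v)) ∧ away
    Agrees-split = all-pick _ v L

    Agrees-∷-split : Agrees L r (v ∷ X) ≡ ((v ∈ᵇ L) ⇒ᵇ r v) ∧ away
    Agrees-∷-split rewrite all-pick (λ y → (y ∈ᵇ (v ∷ X)) ==ᵇ r y) v L | ≡ᵇ-refl v =
      cong (((v ∈ᵇ L) ⇒ᵇ r v) ∧_) (all-cong-∈ L (λ y _ → same-away y))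
      where
      same-away : ∀ y → (y ≡ᵇ v) ∨ (((y ≡ᵇ v) ∨ (y ∈ᵇ X)) ==ᵇ r y) ≡ (y ≡ᵇ v) ∨ ((y ∈ᵇ X) ==ᵇ r y)
      same-away y with y ≡ᵇ v
      ... | true  = refl
      ... | false = refl

    Agrees-without-split : Agrees L (r without v) X ≡ ((v ∈ᵇ L) ⇒ᵇ ((v ∈ᵇ X) ==ᵇ false)) ∧ away
    Agrees-without-split rewrite all-pick (λ y → (y ∈ᵇ X) ==ᵇ (r without v) y) v L | ≡ᵇ-refl v =
      cong (((v ∈ᵇ L) ⇒ᵇ ((v ∈ᵇ X) ==ᵇ false)) ∧_) (all-cong-∈ L (λ y _ → same-away y))
      where
      same-away : ∀ y → (y ≡ᵇ v) ∨ ((y ∈ᵇ X) ==ᵇ (r without v) y) ≡ (y ≡ᵇ v) ∨ ((y ∈ᵇ X) ==ᵇ r y)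
      same-away y with y ≡ᵇ v
      ... | true  = refl
      ... | false = refl

  Agrees-∷-∉ : (v ∈ᵇ L) ≡ false → Agrees L r (v ∷ X) ≡ Agrees L r X
  Agrees-∷-∉ v∉L rewrite Agrees-∷-split | Agrees-split | v∉L = refl

  Agrees-∷-rejected : (v ∈ᵇ L) ≡ true → r v ≡ false → Agrees L r (v ∷ X) ≡ false
  Agrees-∷-rejected v∈L rv≡false rewrite Agrees-∷-split | v∈L | rv≡false = refl

  -- an accepted point v of L is either hit again by X or, if not, removed from the selection
  𝟙-Agrees-∷-accepted : (v ∈ᵇ L) ≡ true → r v ≡ true →
    𝟙 (Agrees L r (v ∷ X)) ≡ 𝟙 (Agrees L r X) + 𝟙 (Agrees L (r without v) X)
  𝟙-Agrees-∷-accepted v∈L rv≡true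
    rewrite Agrees-∷-split | Agrees-split | Agrees-without-split | v∈L | rv≡true with v ∈ᵇ X
  ... | true  = sym (+-identityʳ (𝟙 away))
  ... | false = refl

boundedBy : ∀ {m} → Vec ℕ m → Vec ℕ m → Bool
boundedBy []       []      = true
boundedBy (u ∷ us) (v ∷ f) = (v ≤ᵇ u) ∧ boundedBy us f

boundedBy⁻ : ∀ {m} (us f : Vec ℕ m) → boundedBy us f ≡ true → ∀ x → lookup f x ≤ lookup us x
boundedBy⁻ (u ∷ us) (v ∷ f) bounded x with v ≤ᵇ u in v≤u
boundedBy⁻ (u ∷ us) (v ∷ f) bounded fz     | true = ≤ᵇ⇒≤ v u (≡true⇒T v≤u)
boundedBy⁻ (u ∷ us) (v ∷ f) bounded (fs x) | true = boundedBy⁻ us f bounded x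

boundedBy⁺ : ∀ {m} (us f : Vec ℕ m) → (∀ x → lookup f x ≤ lookup us x) → boundedBy us f ≡ true
boundedBy⁺ []       []      _       = refl
boundedBy⁺ (u ∷ us) (v ∷ f) bounded rewrite T⇒≡true (≤⇒≤ᵇ (bounded fz)) = boundedBy⁺ us f (bounded ∘ fs)

∑-allVecs-𝟙≡ᵇ : ∀ {k} a l (n : Vec ℕ k) → (∀ j → lookup n j ∈ range a l) →
  ∑[ g ∈ allVecs k (range a l) ] 𝟙 (allFinᵇ k (λ j → lookup g j ≡ᵇ lookup n j)) ≡ 1
∑-allVecs-𝟙≡ᵇ {zero}  a l []      _   = refl
∑-allVecs-𝟙≡ᵇ {suc k} a l (y ∷ n) n∈r = begin
  ∑[ g ∈ allVecs (suc k) (range a l) ] 𝟙 (allFinᵇ (suc k) (λ j → lookup g j ≡ᵇ lookup (y ∷ n) j))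
    ≡⟨ ∑-allVecs-suc k (range a l) _ ⟩
  ∑[ v ∈ range a l ] ∑[ w ∈ allVecs k (range a l) ] 𝟙 (allFinᵇ (suc k) (λ j → lookup (v ∷ w) j ≡ᵇ lookup (y ∷ n) j))
    ≡⟨ ∑-cong (range a l) (λ v → trans (∑-cong (allVecs k (range a l)) (λ w →
         trans (cong 𝟙 (allFinᵇ-suc (λ j → lookup (v ∷ w) j ≡ᵇ lookup (y ∷ n) j))) (𝟙-∧ (v ≡ᵇ y) _)))
       (trans (∑-*ˡ (allVecs k (range a l)) (𝟙 (v ≡ᵇ y)) _)
              (cong (𝟙 (v ≡ᵇ y) *_) (∑-allVecs-𝟙≡ᵇ a l n (n∈r ∘ fs))))) ⟩
  ∑[ v ∈ range a l ] (𝟙 (v ≡ᵇ y) * 1)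
    ≡⟨ ∑-𝟙≡ᵇ-range a l (λ _ → 1) (n∈r fz) ⟩
  1 ∎
  where open ≡-Reasoning

module Counting {k} (n : Vec ℕ k) (asc : Ascending 0 n) where

  InGap : Fin k → ℕ → Set
  InGap t y = nBefore n t < y × y < nAt n t

  gap-end : ∀ t → suc (nBefore n t) + gapLength n t ≡ nAt n t
  gap-end t = suc+∸∸1 _ _ (asc-prev< asc t)

  ∈-gap⁻ : ∀ {t y} → y ∈ gap n t → InGap t y
  ∈-gap⁻ {t} {y} y∈ with ∈-range⁻ (subst (y ∈_) (gap≡range n t) y∈)
  ... | nb<y , y<end = nb<y , subst (y <_) (gap-end t) y<end

  gap-unique : ∀ {t s y} → InGap t y → InGap s y → s ≡ t
  gap-unique {t} {s} (nbₜ<y , y<nₜ) (nbₛ<y , y<nₛ) with <-cmp (toℕ s) (toℕ t)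
  ... | tri< s<t _ _ = ⊥-elim (<-irrefl refl (<-trans (<-≤-trans y<nₛ (asc-≤prev asc s t s<t)) nbₜ<y))
  ... | tri≈ _ s≡t _ = toℕ-injective s≡t
  ... | tri> _ _ t<s = ⊥-elim (<-irrefl refl (<-trans (<-≤-trans y<nₜ (asc-≤prev asc t s t<s)) nbₛ<y))

  marker∉gap : ∀ {t s} → ¬ InGap s (nAt n t)
  marker∉gap {t} {s} (nbₛ<nₜ , nₜ<nₛ) with <-cmp (toℕ s) (toℕ t)
  ... | tri< s<t _ _ = <-irrefl refl (<-≤-trans nₜ<nₛ (≤-trans (asc-≤prev asc s t s<t) (<⇒≤ (asc-prev< asc t))))
  ... | tri≈ _ s≡t _ rewrite toℕ-injective s≡t = <-irrefl refl nₜ<nₛ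
  ... | tri> _ _ t<s = <-irrefl refl (<-≤-trans nbₛ<nₜ (asc-≤prev asc t s t<s))

  gaps : List ℕ
  gaps = L.concatMap (gap n) (L.allFin k)

  ∈-gaps⁺ : ∀ {t y} → y ∈ gap n t → y ∈ gaps
  ∈-gaps⁺ {t} y∈ = ∈-concatMap⁺ (gap n) (lose (∈-allFin t) y∈)

  marker∉gaps : ∀ t → ¬ nAt n t ∈ gaps
  marker∉gaps t nₜ∈ with Any.satisfied (∈-concatMap⁻ (gap n) {xs = L.allFin k} nₜ∈)
  ... | s , nₜ∈gapₛ = marker∉gap {t} {s} (∈-gap⁻ nₜ∈gapₛ)

  ∑-gap-point : ∀ {t y} (h : ℕ → ℕ) → y ∈ gap n t → ∀ s → ∑[ y′ ∈ gap n s ] (𝟙 (y′ ≡ᵇ y) * h y′) ≡ δ t s * h y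
  ∑-gap-point {t} {y} h y∈ s with t Fin.≟ s
  ... | yes refl = trans (cong (λ xs → ∑[ y′ ∈ xs ] (𝟙 (y′ ≡ᵇ y) * h y′)) (gap≡range n t))
    (trans (∑-𝟙≡ᵇ-range _ _ h (subst (y ∈_) (gap≡range n t) y∈))
        (sym (trans (cong (_* h y) (δ-refl t)) (*-identityˡ (h y)))))
  ... | no t≢s rewrite δ-≢ t≢s =
    ∑-𝟙≡ᵇ-∉ (gap n s) h (λ y∈ₛ → t≢s (sym (gap-unique (∈-gap⁻ y∈) (∈-gap⁻ y∈ₛ))))

  gapCounts : (ℕ → Bool) → Vec ℕ k
  gapCounts r = V.tabulate (λ t → ∑[ y ∈ gap n t ] 𝟙 (r y))

  gapCounts-without : ∀ r {t y} → r y ≡ true → y ∈ gap n t → gapCounts (r without y) ≡ decrementAt (gapCounts r) t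
  gapCounts-without r {t} {y} ry≡true y∈ =
    trans (VP.tabulate-cong count) (VP.tabulate∘lookup (decrementAt (gapCounts r) t))
    where
    split : ∀ y′ → 𝟙 (r y′) ≡ 𝟙 ((r without y) y′) + 𝟙 (y′ ≡ᵇ y) * 𝟙 (r y′)
    split y′ with y′ ≡ᵇ y
    ... | true  = sym (+-identityʳ _)
    ... | false = sym (+-identityʳ _)
    count : ∀ s → ∑[ y′ ∈ gap n s ] 𝟙 ((r without y) y′) ≡ lookup (decrementAt (gapCounts r) t) s
    count s = sym (begin
      lookup (decrementAt (gapCounts r) t) s
        ≡⟨ trans (lookup-decrementAt (gapCounts r) t s) (cong (_∸ δ t s) (VP.lookup∘tabulate _ s)) ⟩
      ∑[ y′ ∈ gap n s ] 𝟙 (r y′) ∸ δ t s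
        ≡⟨ cong (_∸ δ t s) (trans (∑-cong (gap n s) split) (∑-+ (gap n s) _ _)) ⟩
      ∑[ y′ ∈ gap n s ] 𝟙 ((r without y) y′) + ∑[ y′ ∈ gap n s ] (𝟙 (y′ ≡ᵇ y) * 𝟙 (r y′)) ∸ δ t s
        ≡⟨ cong (λ x → ∑[ y′ ∈ gap n s ] 𝟙 ((r without y) y′) + x ∸ δ t s)
                (trans (∑-gap-point {t} (𝟙 ∘ r) y∈ s)
                    (trans (cong (λ b → δ t s * 𝟙 b) ry≡true) (*-identityʳ (δ t s)))) ⟩
      ∑[ y′ ∈ gap n s ] 𝟙 ((r without y) y′) + δ t s ∸ δ t s
        ≡⟨ m+n∸n≡m _ (δ t s) ⟩
      ∑[ y′ ∈ gap n s ] 𝟙 ((r without y) y′) ∎)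
      where open ≡-Reasoning

  values : List ℕ
  values = range 1 (nTop n)

  countMaps : ∀ {m} → Vec ℕ m → (ℕ → Bool) → ℕ
  countMaps {m} us r = ∑[ f ∈ allVecs m values ] (𝟙 (boundedBy us f) * 𝟙 (Agrees gaps r (V.toList f)))

  afterFirst : ∀ {m} → Vec ℕ m → (ℕ → Bool) → ℕ → ℕ
  afterFirst us r v =
    if v ∈ᵇ gaps then (if r v then countMaps us r + countMaps us (r without v) else 0) else countMaps us r

  ∑-afterFirst : ∀ {m} (us : Vec ℕ m) r v →
    ∑[ w ∈ allVecs m values ] (𝟙 (boundedBy us w) * 𝟙 (Agrees gaps r (v ∷ V.toList w)))
      ≡ (if v ∈ᵇ gaps then (if r v then countMaps us r + countMaps us (r without v) else 0) else countMaps us r)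
  ∑-afterFirst {m} us r v with v ∈ᵇ gaps in v∈? | r v in rv
  ... | false | _     = ∑-cong W
      (λ w → cong (λ b → 𝟙 (boundedBy us w) * 𝟙 b) (Agrees-∷-∉ gaps r v (V.toList w) v∈?))
    where W = allVecs m values
  ... | true  | false = ∑-zero W (λ w _ →
    trans (cong (λ b → 𝟙 (boundedBy us w) * 𝟙 b) (Agrees-∷-rejected gaps r v (V.toList w) v∈? rv))
        (*-zeroʳ (𝟙 (boundedBy us w))))
    where W = allVecs m values
  ... | true  | true  = trans (∑-cong W (λ w →
    trans (cong (𝟙 (boundedBy us w) *_) (𝟙-Agrees-∷-accepted gaps r v (V.toList w) v∈? rv))
        (*-distribˡ-+ (𝟙 (boundedBy us w)) _ _)))
    (∑-+ W (λ w → 𝟙 (boundedBy us w) * 𝟙 (Agrees gaps r (V.toList w)))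
           (λ w → 𝟙 (boundedBy us w) * 𝟙 (Agrees gaps (r without v) (V.toList w))))
    where W = allVecs m values

  afterFirst-marker : ∀ {m} (us : Vec ℕ m) r t → afterFirst us r (nAt n t) ≡ countMaps us r
  afterFirst-marker us r t =
    cong (λ b → if b then (if r nₜ then countMaps us r + countMaps us (r without nₜ) else 0) else countMaps us r)
         (∈ᵇ-false (marker∉gaps t))
    where nₜ = nAt n t

  afterFirst-gap : ∀ {m} (us : Vec ℕ m) r {t y} → y ∈ gap n t →
    afterFirst us r y ≡ (countMaps us r + countMaps us (r without y)) * 𝟙 (r y)
  afterFirst-gap us r {t} {y} y∈ =
    trans (cong (λ b → if b then (if r y then both else 0) else countMaps us r) (∈ᵇ-true (∈-gaps⁺ {t} y∈)))
          (if-then-0 (r y) both)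
    where both = countMaps us r + countMaps us (r without y)

  countMaps-∷ : ∀ {m} u (us : Vec ℕ m) r → countMaps (u ∷ us) r ≡ ∑[ v ∈ values ] (𝟙 (v ≤ᵇ u) * afterFirst us r v)
  countMaps-∷ {m} u us r = trans (∑-allVecs-suc m values _) (∑-cong values (λ v →
    trans (∑-cong W (λ w → trans (cong (_* _) (𝟙-∧ (v ≤ᵇ u) (boundedBy us w))) (*-assoc (𝟙 (v ≤ᵇ u)) _ _)))
    (trans (∑-*ˡ W (𝟙 (v ≤ᵇ u)) _) (cong (𝟙 (v ≤ᵇ u) *_) (∑-afterFirst us r v)))))
    where W = allVecs m values

  no-points-on-gaps : ∀ r → Agrees gaps r [] ≡ isZeroVec (gapCounts r)
  no-points-on-gaps r = begin
    all (not ∘ r) gaps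
      ≡⟨ all-concatMap (gap n) (not ∘ r) (L.allFin k) ⟩
    all (λ t → all (not ∘ r) (gap n t)) (L.allFin k)
      ≡⟨ all-cong-∈ (L.allFin k) (λ t _ → trans (all-not≡∑𝟙≡ᵇ0 r (gap n t))
                                                 (cong (_≡ᵇ 0) (sym (VP.lookup∘tabulate _ t)))) ⟩
    allFinᵇ k (λ t → lookup (gapCounts r) t ≡ᵇ 0)
      ≡⟨ sym (isZeroVec≡allFinᵇ (gapCounts r)) ⟩
    isZeroVec (gapCounts r) ∎
    where open ≡-Reasoning

  countMaps≡φ : ∀ {m} (js : Vec (Fin k) m) r → countMaps (V.map (lookup n) js) r ≡ φ js (gapCounts r)
  countMaps≡φ []       r = trans (+-identityʳ _) (trans (*-identityˡ _) (cong 𝟙 (no-points-on-gaps r)))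
  countMaps≡φ (j ∷ js) r = begin
    countMaps (lookup n j ∷ us) r
      ≡⟨ countMaps-∷ (lookup n j) us r ⟩
    ∑[ v ∈ values ] (𝟙 (v ≤ᵇ lookup n j) * afterFirst us r v)
      ≡⟨ ∑-range-≤ᵇ (lookup n j) (nTop n) (afterFirst us r) (asc-≤top asc j) ⟩
    ∑ (range 1 (lookup n j)) (afterFirst us r)
      ≡⟨ ∑-range-layout 0 n asc j (afterFirst us r) ⟩
    sumUpTo j (λ t → ∑ (range (suc (nBefore n t)) (gapLength n t)) (afterFirst us r) + afterFirst us r (lookup n t))
      ≡⟨ sumUpTo-cong j (λ t _ → cong₂ _+_ (in-gap t) (at-marker t)) ⟩
    sumUpTo j (λ t → (φ js I + φ js (decrementAt I t)) * lookup I t + φ js I)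
      ≡⟨ sumUpTo-cong j (λ t _ → regroup (lookup I t) (φ js I) (φ js (decrementAt I t))) ⟩
    φ (j ∷ js) I ∎
    where
    open ≡-Reasoning
    us = V.map (lookup n) js
    I = gapCounts r
    regroup : ∀ i a b → (a + b) * i + a ≡ suc i * a + i * b
    regroup = solve-∀
    at-marker : ∀ t → afterFirst us r (lookup n t) ≡ φ js I
    at-marker t = trans (afterFirst-marker us r t) (countMaps≡φ js r)
    at-gap-point : ∀ {t} y → y ∈ gap n t → afterFirst us r y ≡ (φ js I + φ js (decrementAt I t)) * 𝟙 (r y)
    at-gap-point {t} y y∈ = trans (afterFirst-gap us r {t} y∈) (by-value (r y) refl)
      where
      by-value : ∀ b → r y ≡ b →
        (countMaps us r + countMaps us (r without y)) * 𝟙 b ≡ (φ js I + φ js (decrementAt I t)) * 𝟙 b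
      by-value true  ry≡true = cong (_* 1) (cong₂ _+_ (countMaps≡φ js r)
        (trans (countMaps≡φ js (r without y)) (cong (φ js) (gapCounts-without r ry≡true y∈))))
      by-value false _       = trans (*-zeroʳ (countMaps us r + countMaps us (r without y)))
                                      (sym (*-zeroʳ (φ js I + φ js (decrementAt I t))))
    in-gap : ∀ t → ∑ (range (suc (nBefore n t)) (gapLength n t)) (afterFirst us r)
                     ≡ (φ js I + φ js (decrementAt I t)) * lookup I t
    in-gap t = begin
      ∑ (range (suc (nBefore n t)) (gapLength n t)) (afterFirst us r)
        ≡⟨ cong (λ xs → ∑ xs (afterFirst us r)) (sym (gap≡range n t)) ⟩
      ∑ (gap n t) (afterFirst us r)
        ≡⟨ ∑-cong-∈ (gap n t) (at-gap-point {t}) ⟩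
      ∑[ y ∈ gap n t ] ((φ js I + φ js (decrementAt I t)) * 𝟙 (r y))
        ≡⟨ ∑-*ˡ (gap n t) (φ js I + φ js (decrementAt I t)) (𝟙 ∘ r) ⟩
      (φ js I + φ js (decrementAt I t)) * ∑[ y ∈ gap n t ] 𝟙 (r y)
        ≡⟨ cong ((φ js I + φ js (decrementAt I t)) *_)
            (sym (VP.lookup∘tabulate (λ s → ∑[ y ∈ gap n s ] 𝟙 (r y)) t)) ⟩
      (φ js I + φ js (decrementAt I t)) * lookup I t ∎

-- Filtered pointed maps

blocks : ∀ {k} (β : Vec ℕ k) → Vec (Fin k) (V.sum β)
blocks []      = []
blocks (b ∷ β) = V.replicate b fz V.++ V.map fs (blocks β)

occurrences-++ : ∀ {k m m′} (xs : Vec (Fin k) m) (ys : Vec (Fin k) m′) i →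
  occurrences (xs V.++ ys) i ≡ occurrences xs i + occurrences ys i
occurrences-++ []       ys i = refl
occurrences-++ (x ∷ xs) ys i = trans (cong (δ x i +_) (occurrences-++ xs ys i)) (sym (+-assoc (δ x i) _ _))

occurrences-replicate : ∀ {k} b (i : Fin (suc k)) → occurrences (V.replicate b fz) i ≡ b * δ fz i
occurrences-replicate zero    i = refl
occurrences-replicate (suc b) i = cong (δ fz i +_) (occurrences-replicate b i)

occurrences-map-fs : ∀ {k m} (js : Vec (Fin k) m) i → occurrences (V.map fs js) (fs i) ≡ occurrences js i
occurrences-map-fs []       i = refl
occurrences-map-fs (j ∷ js) i = cong (δ j i +_) (occurrences-map-fs js i)

occurrences-map-fs-fz : ∀ {k m} (js : Vec (Fin k) m) → occurrences (V.map fs js) fz ≡ 0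
occurrences-map-fs-fz []       = refl
occurrences-map-fs-fz (j ∷ js) = occurrences-map-fs-fz js

occurrences-blocks : ∀ {k} (β : Vec ℕ k) i → occurrences (blocks β) i ≡ lookup β i
occurrences-blocks (b ∷ β) fz = trans (occurrences-++ (V.replicate b fz) _ fz)
  (trans (cong₂ _+_ (trans (occurrences-replicate b fz) (*-identityʳ b)) (occurrences-map-fs-fz (blocks β)))
      (+-identityʳ b))
occurrences-blocks (b ∷ β) (fs i) = trans (occurrences-++ (V.replicate b fz) _ (fs i))
  (cong₂ _+_ (trans (occurrences-replicate b (fs i)) (*-zeroʳ b))
      (trans (occurrences-map-fs (blocks β) i) (occurrences-blocks β i)))

prodAt-++ : ∀ {k m m′} (n : Vec ℕ k) (xs : Vec (Fin k) m) (ys : Vec (Fin k) m′) →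
  prodAt n (xs V.++ ys) ≡ prodAt n xs * prodAt n ys
prodAt-++ n []       ys = sym (+-identityʳ _)
prodAt-++ n (x ∷ xs) ys = trans (cong (lookup n x *_) (prodAt-++ n xs ys)) (sym (*-assoc (lookup n x) _ _))

prodAt-replicate : ∀ {k} a (n : Vec ℕ k) b → prodAt (a ∷ n) (V.replicate b fz) ≡ a ^ b
prodAt-replicate a n zero    = refl
prodAt-replicate a n (suc b) = cong (a *_) (prodAt-replicate a n b)

prodAt-map-fs : ∀ {k m} a (n : Vec ℕ k) (js : Vec (Fin k) m) → prodAt (a ∷ n) (V.map fs js) ≡ prodAt n js
prodAt-map-fs a n []       = refl
prodAt-map-fs a n (j ∷ js) = cong (lookup n j *_) (prodAt-map-fs a n js)

lhs≡prodAt-blocks : ∀ {k} (n β : Vec ℕ k) → lhs n β ≡ prodAt n (blocks β)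
lhs≡prodAt-blocks []      []      = refl
lhs≡prodAt-blocks (a ∷ n) (b ∷ β) = sym (trans (prodAt-++ (a ∷ n) (V.replicate b fz) _)
  (cong₂ _*_ (prodAt-replicate a n b) (trans (prodAt-map-fs a n (blocks β)) (sym (lhs≡prodAt-blocks n β)))))

prefixFrom-+ : ∀ {k} a (β : Vec ℕ k) j → lookup (prefixFrom a β) j ≡ a + lookup (prefix β) j
prefixFrom-+ a (x ∷ β) fz     = refl
prefixFrom-+ a (x ∷ β) (fs j) =
  trans (prefixFrom-+ (a + x) β j) (trans (+-assoc a x _) (cong (a +_) (sym (prefixFrom-+ x β j))))

prefix-suc : ∀ {k} b (β : Vec ℕ k) j → lookup (prefix (suc b ∷ β)) j ≡ suc (lookup (prefix (b ∷ β)) j)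
prefix-suc b β fz     = refl
prefix-suc b β (fs j) = trans (prefixFrom-+ (suc b) β j) (cong suc (sym (prefixFrom-+ b β j)))

-- positions x are counted from 0, so x lies in block j iff b_(j-1) ≤ x < b_j
BlockOf : ∀ {k} (β : Vec ℕ k) → Fin (V.sum β) → Fin k → Set
BlockOf β x j = toℕ x < lookup (prefix β) j × (∀ j′ → toℕ x < lookup (prefix β) j′ → toℕ j ≤ toℕ j′)

mutual
  blocks-spec : ∀ {k} (β : Vec ℕ k) x → BlockOf β x (lookup (blocks β) x)
  blocks-spec (b ∷ β) x = blocks-spec-∷ b β x

  blocks-spec-∷ : ∀ {k} b (β : Vec ℕ k) (x : Fin (b + V.sum β)) → BlockOf (b ∷ β) x (lookup (blocks (b ∷ β)) x)
  blocks-spec-∷ zero β x rewrite VP.lookup-map x fs (blocks β) = proj₁ (blocks-spec β x) , least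
    where
    least : ∀ j → toℕ x < lookup (prefix (0 ∷ β)) j → suc (toℕ (lookup (blocks β) x)) ≤ toℕ j
    least (fs j) x<bⱼ = s≤s (proj₂ (blocks-spec β x) j x<bⱼ)
  blocks-spec-∷ (suc b) β fz     = s≤s z≤n , λ _ _ → z≤n
  blocks-spec-∷ (suc b) β (fs x) with blocks-spec-∷ b β x
  ... | x<b , least = subst (suc (toℕ x) <_) (sym (prefix-suc b β (lookup (blocks (b ∷ β)) x))) (s≤s x<b)
                    , λ j x<bⱼ → least j (≤-pred (subst (suc (toℕ x) <_) (prefix-suc b β j) x<bⱼ))

-- filtered and pointed restate the two conjuncts of isFPM, which are local to its definition
module FilteredPointedMaps {k} (β n : Vec ℕ k) (asc : Ascending 0 n) where
  open Counting n asc

  filtered : Vec ℕ (V.sum β) → Bool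
  filtered f = allFinᵇ k (λ j → allFinᵇ (V.sum β) (λ x → (toℕ x <ᵇ lookup (prefix β) j) ⇒ᵇ (lookup f x ≤ᵇ nAt n j)))

  pointed : Vec ℕ k → Bool
  pointed g = allFinᵇ k (λ j → lookup g j ≡ᵇ nAt n j)

  blockBounds : Vec ℕ (V.sum β)
  blockBounds = V.map (lookup n) (blocks β)

  filtered≡boundedBy : ∀ (f : Vec ℕ (V.sum β)) → filtered f ≡ boundedBy blockBounds f
  filtered≡boundedBy f = bool-ext filtered⇒bounded bounded⇒filtered
    where
    bound-at : ∀ x → lookup blockBounds x ≡ nAt n (lookup (blocks β) x)
    bound-at x = VP.lookup-map x (lookup n) (blocks β)
    filtered⇒bounded : filtered f ≡ true → boundedBy blockBounds f ≡ true
    filtered⇒bounded filt = boundedBy⁺ blockBounds f (λ x →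
      let x<bⱼ  = T⇒≡true (<⇒<ᵇ (proj₁ (blocks-spec β x)))
          fₓ≤nⱼ = ⇒ᵇ-elim (allFinᵇ⁻ _ (allFinᵇ⁻ _ filt (lookup (blocks β) x)) x) x<bⱼ
      in subst (lookup f x ≤_) (sym (bound-at x)) (≤ᵇ⇒≤ _ _ (≡true⇒T fₓ≤nⱼ)))
    bounded⇒filtered : boundedBy blockBounds f ≡ true → filtered f ≡ true
    bounded⇒filtered bounded = allFinᵇ⁺ _ (λ j → allFinᵇ⁺ _ (λ x → ⇒ᵇ-intro (λ x<bⱼ →
      T⇒≡true (≤⇒≤ᵇ (≤-trans (subst (lookup f x ≤_) (bound-at x) (boundedBy⁻ blockBounds f bounded x))
                              (asc-mono asc _ j (proj₂ (blocks-spec β x) j (<ᵇ⇒< _ _ (≡true⇒T x<bⱼ)))))))))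

  pointed⇒≡ : ∀ (g : Vec ℕ k) → pointed g ≡ true → g ≡ n
  pointed⇒≡ g pt = trans (sym (VP.tabulate∘lookup g))
    (trans (VP.tabulate-cong (λ j → ≡ᵇ-true⇒≡ (allFinᵇ⁻ _ pt j))) (VP.tabulate∘lookup n))

  ∑-pointed : ∑[ g ∈ allVecs k values ] 𝟙 (pointed g) ≡ 1
  ∑-pointed = ∑-allVecs-𝟙≡ᵇ 1 (nTop n) n (λ j → ∈-range⁺ (asc-base< asc j) (s≤s (asc-≤top asc j)))

  imageCond≡Agrees : ∀ (f : Vec ℕ (V.sum β)) →
    imageCond n (V.tabulate (gap n)) (f , n) ≡ Agrees gaps (λ _ → true) (V.toList f)
  imageCond≡Agrees f = trans (all-cong-∈ (L.allFin k) (λ j _ → all-cong-∈ (gap n j) (on-gap j)))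
                             (sym (all-concatMap (gap n) (λ y → (y ∈ᵇ V.toList f) ==ᵇ true) (L.allFin k)))
    where
    on-gap : ∀ j y → y ∈ gap n j →
      ((y ∈ᵇ (V.toList f ++ V.toList n)) ==ᵇ (y ∈ᵇ lookup (V.tabulate (gap n)) j)) ≡ ((y ∈ᵇ V.toList f) ==ᵇ true)
    on-gap j y y∈ rewrite ∈ᵇ-++ y (V.toList f) (V.toList n) | VP.lookup∘tabulate (gap n) j | ∈ᵇ-true y∈
      | ∈ᵇ-false (λ y∈n → let t , y≡nₜ = ∈-toList⁻ n y∈n in marker∉gap {t} {j} (subst (InGap j) y≡nₜ (∈-gap⁻ y∈)))
      = cong (_==ᵇ true) (∨-identityʳ (y ∈ᵇ V.toList f))

  countFPM≡countMaps : countFPM β n (V.tabulate (gap n)) ≡ countMaps blockBounds (λ _ → true)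
  countFPM≡countMaps = begin
    countFPM β n Y
      ≡⟨ length-filterᵇ (λ fg → isFPM β n fg ∧ imageCond n Y fg) (L.cartesianProduct A G) ⟩
    ∑[ fg ∈ L.cartesianProduct A G ] 𝟙 (isFPM β n fg ∧ imageCond n Y fg)
      ≡⟨ ∑-cartesianProduct A G (λ fg → 𝟙 (isFPM β n fg ∧ imageCond n Y fg)) ⟩
    ∑[ f ∈ A ] ∑[ g ∈ G ] 𝟙 ((filtered f ∧ pointed g) ∧ imageCond n Y (f , g))
      ≡⟨ ∑-cong A (λ f → trans (∑-cong G (only-n f))
                              (trans (∑-*ˡ G (at-n f) (𝟙 ∘ pointed)) (cong (at-n f *_) pointed-once))) ⟩
    ∑[ f ∈ A ] (𝟙 (filtered f ∧ imageCond n Y (f , n)) * 1)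
      ≡⟨ ∑-cong A (λ f → trans (*-identityʳ _) (trans (𝟙-∧ (filtered f) _)
                          (cong₂ (λ a b → 𝟙 a * 𝟙 b) (filtered≡boundedBy f) (imageCond≡Agrees f)))) ⟩
    ∑[ f ∈ A ] (𝟙 (boundedBy blockBounds f) * 𝟙 (Agrees gaps (λ _ → true) (V.toList f)))
      ≡⟨ cong (λ vs → ∑[ f ∈ allVecs (V.sum β) vs ]
          (𝟙 (boundedBy blockBounds f) * 𝟙 (Agrees gaps (λ _ → true) (V.toList f))))
              (interval≡range 1 (nTop n)) ⟩
    countMaps blockBounds (λ _ → true) ∎
    where
    open ≡-Reasoning
    Y = V.tabulate (gap n)
    A = allVecs (V.sum β) (interval 1 (nTop n))
    G = allVecs k (interval 1 (nTop n))
    at-n : Vec ℕ (V.sum β) → ℕ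
    at-n f = 𝟙 (filtered f ∧ imageCond n Y (f , n))
    pointed-once : ∑[ g ∈ G ] 𝟙 (pointed g) ≡ 1
    pointed-once = trans (cong (λ vs → ∑[ g ∈ allVecs k vs ] 𝟙 (pointed g)) (interval≡range 1 (nTop n))) ∑-pointed
    only-n : ∀ f g → 𝟙 ((filtered f ∧ pointed g) ∧ imageCond n Y (f , g)) ≡ at-n f * 𝟙 (pointed g)
    only-n f g with pointed g in pt
    ... | true  rewrite pointed⇒≡ g pt | ∧-identityʳ (filtered f) = sym (*-identityʳ (at-n f))
    ... | false rewrite ∧-zeroʳ (filtered f) = sym (*-zeroʳ (at-n f))

canon-ascending : ∀ {k} a (I : Vec ℕ k) → Ascending a (prefixFrom a (V.map suc I))
canon-ascending a []      = _
canon-ascending a (i ∷ I) = m<m+n a (s≤s z≤n) , canon-ascending (a + suc i) I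

canon-gap : ∀ {k} a (I : Vec ℕ k) t →
  lookup (prefixFrom a (V.map suc I)) t ∸ prev a (prefixFrom a (V.map suc I)) t ∸ 1 ≡ lookup I t
canon-gap a (i ∷ I) fz     = cong (_∸ 1) (m+n∸m≡n a (suc i))
canon-gap a (i ∷ I) (fs t) = canon-gap (a + suc i) I t

c≡φ : ∀ {k} (β I : Vec ℕ k) → isZeroVec β ≡ false → c β I ≡ φ (blocks β) I
c≡φ β I β≢0 rewrite β≢0 = begin
  countFPM β N (V.tabulate (gap N))
    ≡⟨ FilteredPointedMaps.countFPM≡countMaps β N asc ⟩
  countMaps (V.map (lookup N) (blocks β)) (λ _ → true)
    ≡⟨ countMaps≡φ (blocks β) (λ _ → true) ⟩
  φ (blocks β) (gapCounts (λ _ → true))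
    ≡⟨ cong (φ (blocks β)) whole-gaps ⟩
  φ (blocks β) I ∎
  where
  open ≡-Reasoning
  N = canonN I
  asc = canon-ascending 0 I
  open Counting N asc
  whole-gaps : gapCounts (λ _ → true) ≡ I
  whole-gaps = trans (VP.tabulate-cong (λ t → trans (∑-1≡length (gap N t))
    (trans (cong L.length (gap≡range N t)) (trans (length-range _ _) (canon-gap 0 I t))))) (VP.tabulate∘lookup I)

indexCond : ∀ {k} → Vec ℕ k → Vec ℕ k → Bool
indexCond {k} β I = allFinᵇ k (λ j → sufSum I j ≤ᵇ sufSum β j)

φ≢0⇒indexCond : ∀ {k} (β I : Vec ℕ k) → φ (blocks β) I ≢ 0 → indexCond β I ≡ true
φ≢0⇒indexCond β I ≢0 = allFinᵇ⁺ _ (λ j → T⇒≡true (≤⇒≤ᵇ (≤-trans (φ≢0⇒dominated (blocks β) I ≢0 j)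
  (≤-reflexive (sufSum-cong (V.tabulate (occurrences (blocks β))) β
    (λ i → trans (VP.lookup∘tabulate (occurrences (blocks β)) i) (occurrences-blocks β i)) j)))))

-- the condition at j = 1 already forces I = 0; this is where k ≥ 1 is needed
indexCond-zero : ∀ {k} (β I : Vec ℕ (suc k)) → isZeroVec β ≡ true → indexCond β I ≡ isZeroVec I
indexCond-zero {k} β I β≡0 = bool-ext
  (λ cond → isZeroVec⁺ I (λ i → ∑≡0⇒ (L.allFin (suc k)) (lookup I)
     (n≤0⇒n≡0 (subst (sufSum I fz ≤_) (sufSum-zero β (isZeroVec-lookup β β≡0) fz)
                     (≤ᵇ⇒≤ _ _ (≡true⇒T (allFinᵇ⁻ (λ j → sufSum I j ≤ᵇ sufSum β j) cond fz))))) i (∈-allFin i)))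
  (λ I≡0 → allFinᵇ⁺ (λ j → sufSum I j ≤ᵇ sufSum β j)
      (λ j → cong (_≤ᵇ sufSum β j) (sufSum-zero I (isZeroVec-lookup I I≡0) j)))

sum-isZeroVec : ∀ {k} (β : Vec ℕ k) → isZeroVec β ≡ true → V.sum β ≡ 0
sum-isZeroVec []         _   = refl
sum-isZeroVec (zero ∷ β) β≡0 = sum-isZeroVec β β≡0

c-zero : ∀ {k} (β I : Vec ℕ k) → isZeroVec β ≡ true → c β I ≡ 1
c-zero β I β≡0 rewrite β≡0 = refl

𝟙indexCond*φ≡φ : ∀ {k} (β I : Vec ℕ k) → 𝟙 (indexCond β I) * φ (blocks β) I ≡ φ (blocks β) I
𝟙indexCond*φ≡φ β I with φ (blocks β) I ≟ 0
... | yes φ≡0 rewrite φ≡0 = *-zeroʳ (𝟙 (indexCond β I))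
... | no  φ≢0 rewrite φ≢0⇒indexCond β I φ≢0 = +-identityʳ _

𝟙indexCond*c≡φ : ∀ {k} (β I : Vec ℕ (suc k)) → 𝟙 (indexCond β I) * c β I ≡ φ (blocks β) I
𝟙indexCond*c≡φ β I = by-cases (isZeroVec β) refl
  where
  by-cases : ∀ b → isZeroVec β ≡ b → 𝟙 (indexCond β I) * c β I ≡ φ (blocks β) I
  by-cases true  β≡0 = begin
    𝟙 (indexCond β I) * c β I ≡⟨ trans (cong (𝟙 (indexCond β I) *_) (c-zero β I β≡0)) (*-identityʳ _) ⟩
    𝟙 (indexCond β I)         ≡⟨ cong 𝟙 (indexCond-zero β I β≡0) ⟩
    𝟙 (isZeroVec I)           ≡⟨ sym (φ-length-zero (blocks β) I (sum-isZeroVec β β≡0)) ⟩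
    φ (blocks β) I            ∎
    where open ≡-Reasoning
  by-cases false β≢0 = trans (cong (𝟙 (indexCond β I) *_) (c≡φ β I β≢0)) (𝟙indexCond*φ≡φ β I)

lemma5p3 : (k : ℕ) → 1 ≤ k → (n β : Vec ℕ k) → PosStrictIncr n →
    lhs n β ≡
      sum (L.map (λ I → c β I *
                V.foldr _ _*_ 1 (V.tabulate (λ j → (nAt n j ∸ nBefore n j ∸ 1) C lookup I j)))
             (indexSet β))
lemma5p3 (suc k) _ n β incr = begin
  lhs n β
    ≡⟨ lhs≡prodAt-blocks n β ⟩
  prodAt n (blocks β)
    ≡⟨ expansion n g n≡∑gaps (blocks β) (V.sum β) ≤-refl ⟩
  ∑[ I ∈ box (suc k) (V.sum β) ] (φ (blocks β) I * binomials g I)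
    ≡⟨ ∑-cong (box (suc k) (V.sum β)) (λ I →
         trans (cong₂ _*_ (sym (𝟙indexCond*c≡φ β I)) (sym (binomials-tabulate (gapLength n) I)))
               (*-assoc (𝟙 (indexCond β I)) (c β I) _)) ⟩
  ∑[ I ∈ box (suc k) (V.sum β) ]
      (𝟙 (indexCond β I) * (c β I * V.foldr _ _*_ 1 (V.tabulate (λ j → gapLength n j C lookup I j))))
    ≡⟨ sym (∑-filterᵇ (indexCond β) (box (suc k) (V.sum β)) _) ⟩
  ∑[ I ∈ indexSet β ] (c β I * V.foldr _ _*_ 1 (V.tabulate (λ j → gapLength n j C lookup I j))) ∎
  where
  open ≡-Reasoning
  g = V.tabulate (gapLength n)
  n≡∑gaps : ∀ j → sumUpTo j (λ t → suc (lookup g t)) ≡ lookup n j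
  n≡∑gaps j = trans (sumUpTo-cong j (λ t _ → cong suc (VP.lookup∘tabulate (gapLength n) t)))
                    (sumUpTo-gaps 0 n (ascending 0 n incr) j)
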